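{- Let $q$ be a prime power and $n,d$ positive integers. Let $\mathcal{P}$ be a set of points in $\mathbb{F}_q^{n+d}$ and $\mathcal{F}$ a set of $n$-flats (affine subspaces of dimension $n$) in $\mathbb{F}_q^{n+d}$. Then, if $d\ge2$, $$\left|I(\mathcal{P},\mathcal{F})-\frac{|\mathcal{P}||\mathcal{F}|}{q^d}\right|\le q^{n/2}\sqrt{|\mathcal{P}||\mathcal{F}|}\left(\frac{|\mathcal{F}|}{q}+\frac{\binom{n+d}{d}_q}{q^{dn}}\right)^{1/2},$$ and if $d=1$, $$\left|I(\mathcal{P},\mathcal{F})-\frac{|\mathcal{P}||\mathcal{F}|}{q}\right|\le q^{n/2}\left(1-\frac1q\right)\sqrt{|\mathcal{P}||\mathcal{F}|}\left(\frac{\binom{n+1}{1}_q}{q^n}\right)^{1/2}.$$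
   Context: $I(\mathcal{P},\mathcal{F})$ denotes the number of pairs $(\mathbf{p},F)\in\mathcal{P}\times\mathcal{F}$ with $\mathbf{p}\in F$. For integers $m\ge k\ge1$, $\binom{m}{k}_q=\prod_{i=0}^{k-1}\frac{q^{m-i}-1}{q^{k-i}-1}$ is the Gaussian binomial coefficient. -}

module Defs where

open import Level using (_⊔_)
open import Algebra.Bundles using (CommutativeRing)
open import Data.Nat as ℕ using (ℕ; zero; suc; _^_; _∸_)
open import Data.Fin using (Fin)
open import Data.List as List using (List; length; map; filter; upTo)
open import Data.Nat.ListAction using (sum; product)
open import Data.List.Relation.Unary.Any using (Any)
open import Data.List.Relation.Unary.AllPairs using (AllPairs)
open import Data.Product using (∃; ∃₂; _×_; _,_)
open import Relation.Nullary using (¬_; Dec)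
open import Relation.Binary.Definitions using (Decidable)
open import Relation.Binary.PropositionalEquality using (_≡_)
open import Data.Vec.Functional using (Vector; foldr)
open import Data.Nat.Primality using (Prime)
open import Data.Rational as ℚ using (ℚ)
open import Data.Integer using (+_)

IsPrimePower : ℕ → Set
IsPrimePower q = ∃₂ λ p k → Prime p × q ≡ p ^ suc k

record IsFiniteField {c ℓ} (K : CommutativeRing c ℓ) (q : ℕ) : Set (c ⊔ ℓ) where
  open CommutativeRing K
  field
    0≉1      : ¬ (0# ≈ 1#)
    inverse  : ∀ x → ¬ (x ≈ 0#) → ∃ λ y → x * y ≈ 1#
    _≟_      : Decidable _≈_
    elements : List Carrier
    complete : ∀ x → Any (x ≈_) elements
    distinct : AllPairs (λ a b → ¬ (a ≈ b)) elements
    card     : length elements ≡ q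

module AffineGeometry {c ℓ} (K : CommutativeRing c ℓ) where
  open CommutativeRing K

  Point : ℕ → Set c
  Point m = Vector Carrier m

  _≈ₚ_ : ∀ {m} → Point m → Point m → Set ℓ
  x ≈ₚ y = ∀ j → x j ≈ y j

  lincomb : ∀ {m n} → Vector Carrier n → Vector (Point m) n → Point m
  lincomb t v j = foldr _+_ 0# (λ i → t i * v i j)

  record Flat (m n : ℕ) : Set (c ⊔ ℓ) where
    field
      base  : Point m
      dir   : Vector (Point m) n
      indep : ∀ (t : Vector Carrier n) → lincomb t dir ≈ₚ (λ _ → 0#) → ∀ i → t i ≈ 0#
  open Flat public

  _∈F_ : ∀ {m n} → Point m → Flat m n → Set (c ⊔ ℓ)
  x ∈F F = ∃ λ (t : Vector Carrier _) → x ≈ₚ (λ j → base F j + lincomb t (dir F) j)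

  SameFlat : ∀ {m n} → Flat m n → Flat m n → Set (c ⊔ ℓ)
  SameFlat F G = ∀ x → (x ∈F F → x ∈F G) × (x ∈F G → x ∈F F)

  incidences : ∀ {m n} → (∀ (x : Point m) (F : Flat m n) → Dec (x ∈F F))
             → List (Point m) → List (Flat m n) → ℕ
  incidences mem? Ps Fs = sum (map (λ p → length (filter (mem? p) Fs)) Ps)

ℕtoℚ : ℕ → ℚ
ℕtoℚ n = (+ n) ℚ./ 1

-- x / n  (n = 0 never occurs in our uses; returns 0 then)
_÷ℕ_ : ℚ → ℕ → ℚ
x ÷ℕ zero  = ℚ.0ℚ
x ÷ℕ suc n = x ℚ.* ((+ 1) ℚ./ suc n)

gaussBinom : ℕ → ℕ → ℕ → ℚ
gaussBinom q m k =
  ℕtoℚ (product (map (λ i → q ^ (m ∸ i) ∸ 1) (upTo k)))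
    ÷ℕ product (map (λ i → q ^ (k ∸ i) ∸ 1) (upTo k))

{-# OPTIONS --safe #-}
module Submission where

-- Write r(x) for the number of flats of 𝓕 through a point x of 𝔽_q^(n+d).  An n-flat has q^n
-- points, and two distinct n-flats F, G share at most q^(n-1): in the parameter space of F the
-- preimage of G is closed under x + e (y − z) and misses some point s, so its translates by the
-- multiples of s − t₀ (t₀ in the preimage) are pairwise disjoint.  Hence Σ r(x) = |𝓕| q^n and
-- q Σ r(x)² ≤ |𝓕| q^n (q − 1 + |𝓕|).  Over 𝒫 and over its complement the sums of r(x) deviate from
-- their means by opposite amounts ±Δ, where Δ = I(𝒫, 𝓕) − |𝒫| |𝓕| / q^d, so Cauchy–Schwarz on
-- both parts bounds Δ² by |𝒫| (q^(n+d) − |𝒫|) times the variance of r over all points, which the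
-- second moment controls.  The Gaussian binomials only enter through [n+d choose d]_q ≥ q^(dn) and
-- (q − 1) [n+1 choose 1]_q = q^(n+1) − 1.

open import Algebra.Bundles using (CommutativeRing)
open import Data.Nat.Base using (ℕ)
open import Relation.Binary.Bundles using (Setoid)
open import Defs

-- Every commutative ring is a ℤ-algebra, so the ring solver can run with integer coefficients.
module CommutativeRingSolver {c ℓ} (K : CommutativeRing c ℓ) where
  open import Data.Integer.Base as ℤ using (ℤ; +_; -[1+_]; _⊖_)
  import Data.Integer.Properties as ℤ
  open import Data.Maybe.Base using (Maybe; just; nothing)
  open import Data.Nat.Base as ℕ using (zero; suc)
  import Data.Nat.Properties as ℕ
  open import Relation.Binary.PropositionalEquality.Core as ≡ using (_≡_)
  open import Relation.Nullary.Decidable.Core using (yes; no)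
  import Algebra.Solver.Ring.AlmostCommutativeRing as ACR

  open CommutativeRing K
  open import Algebra.Properties.Monoid.Mult +-monoid using (_×_; ×-homo-+)
  open import Algebra.Properties.Semiring.Mult semiring using (×1-homo-*)
  open import Algebra.Properties.Ring ring using (-‿involutive; -‿distribˡ-*; -‿distribʳ-*; -‿+-comm; -0#≈0#)
  open import Algebra.Properties.CommutativeSemigroup +-commutativeSemigroup using (interchange)
  open import Relation.Binary.Reasoning.Setoid setoid

  ⟦_⟧ : ℤ → Carrier
  ⟦ + n ⟧      = n × 1#
  ⟦ -[1+ n ] ⟧ = - (suc n × 1#)

  ⟦⟧-cong : ∀ {i j} → i ≡ j → ⟦ i ⟧ ≈ ⟦ j ⟧
  ⟦⟧-cong ≡.refl = refl

  +-sub-+ : ∀ x a b → (x + a) - (x + b) ≈ a - b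
  +-sub-+ x a b = begin
    (x + a) - (x + b)    ≈⟨ +-congˡ (-‿+-comm x b) ⟨
    (x + a) + (- x - b)  ≈⟨ interchange x a (- x) (- b) ⟩
    (x - x) + (a - b)    ≈⟨ +-congʳ (-‿inverseʳ x) ⟩
    0# + (a - b)         ≈⟨ +-identityˡ _ ⟩
    a - b                ∎

  ⊖-homo : ∀ m n → ⟦ m ⊖ n ⟧ ≈ m × 1# - n × 1#
  ⊖-homo m       zero    = sym (trans (+-congˡ -0#≈0#) (+-identityʳ _))
  ⊖-homo zero    (suc n) = sym (+-identityˡ _)
  ⊖-homo (suc m) (suc n) = begin
    ⟦ suc m ⊖ suc n ⟧          ≡⟨ ≡.cong ⟦_⟧ (ℤ.[1+m]⊖[1+n]≡m⊖n m n) ⟩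
    ⟦ m ⊖ n ⟧                  ≈⟨ ⊖-homo m n ⟩
    m × 1# - n × 1#            ≈⟨ +-sub-+ 1# _ _ ⟨
    suc m × 1# - suc n × 1#    ∎

  +-homo : ∀ i j → ⟦ i ℤ.+ j ⟧ ≈ ⟦ i ⟧ + ⟦ j ⟧
  +-homo (+ m)    (+ n)    = ×-homo-+ 1# m n
  +-homo (+ m)    -[1+ n ] = ⊖-homo m (suc n)
  +-homo -[1+ m ] (+ n)    = trans (⊖-homo n (suc m)) (+-comm _ _)
  +-homo -[1+ m ] -[1+ n ] = begin
    - (suc (suc (m ℕ.+ n)) × 1#)      ≡⟨ ≡.cong (λ k → - (suc k × 1#)) (ℕ.+-suc m n) ⟨
    - ((suc m ℕ.+ suc n) × 1#)        ≈⟨ -‿cong (×-homo-+ 1# (suc m) (suc n)) ⟩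
    - (suc m × 1# + suc n × 1#)       ≈⟨ -‿+-comm _ _ ⟨
    - (suc m × 1#) + - (suc n × 1#)   ∎

  -‿homo : ∀ i → ⟦ ℤ.- i ⟧ ≈ - ⟦ i ⟧
  -‿homo (+ zero)  = sym -0#≈0#
  -‿homo (+ suc n) = refl
  -‿homo -[1+ n ]  = sym (-‿involutive _)

  *-homo-+ : ∀ m j → ⟦ + m ℤ.* j ⟧ ≈ ⟦ + m ⟧ * ⟦ j ⟧
  *-homo-+ m (+ n)    = trans (⟦⟧-cong (≡.sym (ℤ.pos-* m n))) (×1-homo-* m n)
  *-homo-+ m -[1+ n ] = begin
    ⟦ + m ℤ.* ℤ.- + suc n ⟧        ≡⟨ ≡.cong ⟦_⟧ (ℤ.neg-distribʳ-* (+ m) (+ suc n)) ⟨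
    ⟦ ℤ.- (+ m ℤ.* + suc n) ⟧      ≈⟨ -‿homo (+ m ℤ.* + suc n) ⟩
    - ⟦ + m ℤ.* + suc n ⟧          ≈⟨ -‿cong (*-homo-+ m (+ suc n)) ⟩
    - (m × 1# * suc n × 1#)        ≈⟨ -‿distribʳ-* _ _ ⟩
    m × 1# * - (suc n × 1#)        ∎

  *-homo : ∀ i j → ⟦ i ℤ.* j ⟧ ≈ ⟦ i ⟧ * ⟦ j ⟧
  *-homo (+ m)    j = *-homo-+ m j
  *-homo -[1+ m ] j = begin
    ⟦ ℤ.- + suc m ℤ.* j ⟧          ≡⟨ ≡.cong ⟦_⟧ (ℤ.neg-distribˡ-* (+ suc m) j) ⟨
    ⟦ ℤ.- (+ suc m ℤ.* j) ⟧        ≈⟨ -‿homo (+ suc m ℤ.* j) ⟩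
    - ⟦ + suc m ℤ.* j ⟧            ≈⟨ -‿cong (*-homo-+ (suc m) j) ⟩
    - (suc m × 1# * ⟦ j ⟧)         ≈⟨ -‿distribˡ-* _ _ ⟩
    - (suc m × 1#) * ⟦ j ⟧         ∎

  ℤ⟶K : ℤ.+-*-rawRing ACR.-Raw-AlmostCommutative⟶ ACR.fromCommutativeRing K
  ℤ⟶K = record
    { ⟦_⟧ = ⟦_⟧ ; +-homo = +-homo ; *-homo = *-homo ; -‿homo = -‿homo
    ; 0-homo = refl ; 1-homo = +-identityʳ 1# }

  ⟦⟧-≟ : ∀ i j → Maybe (⟦ i ⟧ ≈ ⟦ j ⟧)
  ⟦⟧-≟ i j with i ℤ.≟ j
  ... | yes i≡j = just (⟦⟧-cong i≡j)
  ... | no _    = nothing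

  open import Algebra.Solver.Ring ℤ.+-*-rawRing (ACR.fromCommutativeRing K) ℤ⟶K ⟦⟧-≟ public
    using (solve; _:=_; _:+_; _:*_; _:-_)

module UniqueListCounting {a ℓ} (S : Setoid a ℓ) where
  open import Data.Empty using (⊥-elim)
  open import Data.List.Base using (List; _∷_; length; map)
  open import Data.List.Properties using (length-removeAt′)
  open import Data.List.Relation.Unary.All using (All)
  open import Data.List.Relation.Unary.AllPairs using ([]; _∷_)
  open import Data.List.Relation.Unary.Any as Any using (here; there; index)
  open import Data.List.Relation.Unary.Any.Properties using (lookup-result)
  open import Data.Nat.Base using (ℕ; _+_; _≤_; z≤n; s≤s)
  open import Data.Nat.ListAction using (sum)
  open import Data.Nat.Properties using (+-mono-≤; ≤-antisym; ≤-reflexive; +-commutativeSemigroup)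
  open import Algebra.Properties.CommutativeSemigroup +-commutativeSemigroup using (x∙yz≈y∙xz)
  open import Relation.Nullary.Negation using (¬_)
  import Relation.Binary.PropositionalEquality.Core as ≡

  open Setoid S renaming (Carrier to A)
  open import Data.List.Membership.Setoid S using (_∈_; _─_)
  open import Data.List.Membership.Setoid.Properties using (∈-resp-≈; All[≉]⇒∉)
  open import Data.List.Relation.Binary.Subset.Setoid S using (_⊆_)
  open import Data.List.Relation.Unary.Unique.Setoid S using (Unique)

  sum-─ : (h : A → ℕ) {x : A} {ys : List A} (p : x ∈ ys) →
          sum (map h ys) ≡.≡ h (Any.lookup p) + sum (map h (ys ─ p))
  sum-─ h (here _)               = ≡.refl
  sum-─ h {ys = y ∷ _} (there p) = ≡.trans (≡.cong (h y +_) (sum-─ h p)) (x∙yz≈y∙xz (h y) (h (Any.lookup p)) _)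

  ∈-─ : ∀ {x y ys} (p : x ∈ ys) → y ∈ ys → ¬ y ≈ Any.lookup p → y ∈ ys ─ p
  ∈-─ (here _)  (here y≈)  y≉ = ⊥-elim (y≉ y≈)
  ∈-─ (here _)  (there y∈) _  = y∈
  ∈-─ (there _) (here y≈)  _  = here y≈
  ∈-─ (there p) (there y∈) y≉ = there (∈-─ p y∈ y≉)

  ⊆-─ : ∀ {x xs ys} → All (λ y → ¬ x ≈ y) xs → (sub : x ∷ xs ⊆ ys) → xs ⊆ ys ─ sub (here refl)
  ⊆-─ x∉xs sub y∈xs = ∈-─ (sub (here refl)) (sub (there y∈xs)) λ y≈ →
    All[≉]⇒∉ S x∉xs (∈-resp-≈ S (trans y≈ (sym (lookup-result (sub (here refl))))) y∈xs)

  length-mono-⊆ : ∀ {xs ys} → Unique xs → xs ⊆ ys → length xs ≤ length ys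
  length-mono-⊆ []                       _   = z≤n
  length-mono-⊆ {ys = ys} (x∉xs ∷ xs!) sub =
    ≡.subst (_ ≤_) (≡.sym (length-removeAt′ ys (index (sub (here refl)))))
      (s≤s (length-mono-⊆ xs! (⊆-─ x∉xs sub)))

  sum-map-mono-⊆ : ∀ {h : A → ℕ} → (∀ {x y} → x ≈ y → h x ≡.≡ h y) →
                   ∀ {xs ys} → Unique xs → xs ⊆ ys → sum (map h xs) ≤ sum (map h ys)
  sum-map-mono-⊆ h-resp []                         _   = z≤n
  sum-map-mono-⊆ {h} h-resp {x ∷ xs} {ys} (x∉xs ∷ xs!) sub =
    ≡.subst (_ ≤_) (≡.sym (sum-─ h x∈ys))
      (+-mono-≤ (≤-reflexive (h-resp (lookup-result x∈ys))) (sum-map-mono-⊆ h-resp xs! (⊆-─ x∉xs sub)))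
    where
    x∈ys : x ∈ ys
    x∈ys = sub (here refl)

  ⊆-⊇⇒length-≡ : ∀ {xs ys} → Unique xs → Unique ys → xs ⊆ ys → ys ⊆ xs → length xs ≡.≡ length ys
  ⊆-⊇⇒length-≡ xs! ys! xs⊆ys ys⊆xs = ≤-antisym (length-mono-⊆ xs! xs⊆ys) (length-mono-⊆ ys! ys⊆xs)

  ⊆-⊇⇒sum-map-≡ : ∀ {h : A → ℕ} → (∀ {x y} → x ≈ y → h x ≡.≡ h y) →
                  ∀ {xs ys} → Unique xs → Unique ys → xs ⊆ ys → ys ⊆ xs → sum (map h xs) ≡.≡ sum (map h ys)
  ⊆-⊇⇒sum-map-≡ h-resp xs! ys! xs⊆ys ys⊆xs =
    ≤-antisym (sum-map-mono-⊆ h-resp xs! xs⊆ys) (sum-map-mono-⊆ h-resp ys! ys⊆xs)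

module NaturalSums where
  open import Data.List.Base using (List; []; _∷_; length; map; filter; cartesianProductWith)
  open import Data.List.Properties using (length-++; length-map)
  open import Data.Nat.Base using (ℕ; suc; _+_; _*_; _≤_; z≤n)
  open import Data.Nat.ListAction using (sum)
  open import Data.Nat.Properties
  open import Data.Nat.Tactic.RingSolver using (solve-∀)
  open import Data.Product.Base using (_,_)
  open import Data.Sum.Base using (inj₁; inj₂)
  open import Relation.Binary.PropositionalEquality
  open import Relation.Nullary.Decidable using (Dec; yes; no; _×-dec_)
  open import Relation.Unary using (Pred; Decidable)
  open import Algebra.Properties.CommutativeSemigroup +-commutativeSemigroup using () renaming (interchange to +-interchange)

  length-cartesianProductWith : ∀ {a b c} {A : Set a} {B : Set b} {C : Set c} (f : A → B → C) xs ys →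
                                length (cartesianProductWith f xs ys) ≡ length xs * length ys
  length-cartesianProductWith f []       ys = refl
  length-cartesianProductWith f (x ∷ xs) ys = trans (length-++ (map (f x) ys))
    (cong₂ _+_ (length-map (f x) ys) (length-cartesianProductWith f xs ys))

  private
    am-gm-≤ : ∀ {a b} → a ≤ b → 2 * a * b ≤ a * a + b * b
    am-gm-≤ {a} a≤b with m≤n⇒∃[o]m+o≡n a≤b
    ... | k , refl = subst (2 * a * (a + k) ≤_) (square-gap a k) (m≤m+n _ (k * k))
      where
      square-gap : ∀ a k → 2 * a * (a + k) + k * k ≡ a * a + (a + k) * (a + k)
      square-gap = solve-∀

  am-gm : ∀ a b → 2 * a * b ≤ a * a + b * b
  am-gm a b with ≤-total a b
  ... | inj₁ a≤b = am-gm-≤ a≤b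
  ... | inj₂ b≤a = subst₂ _≤_ (swap a b) (+-comm (b * b) (a * a)) (am-gm-≤ b≤a)
    where
    swap : ∀ a b → 2 * b * a ≡ 2 * a * b
    swap = solve-∀

  module _ {a} {A : Set a} where

    sum-map-+ : ∀ (f g : A → ℕ) xs → sum (map (λ x → f x + g x) xs) ≡ sum (map f xs) + sum (map g xs)
    sum-map-+ f g []       = refl
    sum-map-+ f g (x ∷ xs) = trans (cong (f x + g x +_) (sum-map-+ f g xs)) (+-interchange (f x) _ _ _)

    sum-map-*ˡ : ∀ k (f : A → ℕ) xs → sum (map (λ x → k * f x) xs) ≡ k * sum (map f xs)
    sum-map-*ˡ k f []       = sym (*-zeroʳ k)
    sum-map-*ˡ k f (x ∷ xs) = trans (cong (k * f x +_) (sum-map-*ˡ k f xs)) (sym (*-distribˡ-+ k (f x) _))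

    sum-map-0 : ∀ (xs : List A) → sum (map (λ _ → 0) xs) ≡ 0
    sum-map-0 []       = refl
    sum-map-0 (_ ∷ xs) = sum-map-0 xs

    cross-term-≤ : ∀ (f : A → ℕ) a xs →
                   2 * a * sum (map f xs) ≤ length xs * (a * a) + sum (map (λ x → f x * f x) xs)
    cross-term-≤ f a []       = ≤-reflexive (*-zeroʳ (2 * a))
    cross-term-≤ f a (x ∷ xs) = begin
      2 * a * (f x + S)                                ≡⟨ *-distribˡ-+ (2 * a) (f x) S ⟩
      2 * a * f x + 2 * a * S                          ≤⟨ +-mono-≤ (am-gm a (f x)) (cross-term-≤ f a xs) ⟩
      (a * a + f x * f x) + (length xs * (a * a) + T)  ≡⟨ regroup (a * a) (f x * f x) (length xs) T ⟩
      suc (length xs) * (a * a) + (f x * f x + T)      ∎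
      where
      open ≤-Reasoning
      S T : ℕ
      S = sum (map f xs)
      T = sum (map (λ x → f x * f x) xs)
      regroup : ∀ a² b² n T → (a² + b²) + (n * a² + T) ≡ suc n * a² + (b² + T)
      regroup = solve-∀

    cauchy-schwarz : ∀ (f : A → ℕ) xs →
                     sum (map f xs) * sum (map f xs) ≤ length xs * sum (map (λ x → f x * f x) xs)
    cauchy-schwarz f []       = z≤n
    cauchy-schwarz f (x ∷ xs) = begin
      (f x + S) * (f x + S)                         ≡⟨ expand (f x) S ⟩
      f x * f x + 2 * f x * S + S * S               ≤⟨ +-mono-≤ (+-monoʳ-≤ (f x * f x) (cross-term-≤ f (f x) xs))
                                                                (cauchy-schwarz f xs) ⟩
      f x * f x + (n * (f x * f x) + T) + n * T     ≡⟨ collect (f x * f x) n T ⟩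
      suc n * (f x * f x + T)                       ∎
      where
      open ≤-Reasoning
      S T n : ℕ
      S = sum (map f xs)
      T = sum (map (λ x → f x * f x) xs)
      n = length xs
      expand : ∀ a S → (a + S) * (a + S) ≡ a * a + 2 * a * S + S * S
      expand = solve-∀
      collect : ∀ a² n T → a² + (n * a² + T) + n * T ≡ suc n * (a² + T)
      collect = solve-∀

  indicator : ∀ {p} {P : Set p} → Dec P → ℕ
  indicator (yes _) = 1
  indicator (no _)  = 0

  indicator-idem : ∀ {p} {P : Set p} (P? : Dec P) → indicator P? * indicator P? ≡ indicator P?
  indicator-idem (yes _) = refl
  indicator-idem (no _)  = refl

  indicator-×-dec : ∀ {p r} {P : Set p} {R : Set r} (P? : Dec P) (R? : Dec R) →
                    indicator P? * indicator R? ≡ indicator (P? ×-dec R?)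
  indicator-×-dec (yes _) (yes _) = refl
  indicator-×-dec (yes _) (no _)  = refl
  indicator-×-dec (no _)  _       = refl

  module _ {a p} {A : Set a} {P : Pred A p} (P? : Decidable P) where

    length-filter-∷ : ∀ x xs → length (filter P? (x ∷ xs)) ≡ indicator (P? x) + length (filter P? xs)
    length-filter-∷ x xs with P? x
    ... | yes _ = refl
    ... | no  _ = refl

    sum-map-indicator : ∀ xs → sum (map (λ x → indicator (P? x)) xs) ≡ length (filter P? xs)
    sum-map-indicator []       = refl
    sum-map-indicator (x ∷ xs) = trans (cong (indicator (P? x) +_) (sum-map-indicator xs)) (sym (length-filter-∷ x xs))

module _ where
  open import Data.Nat.Base using (ℕ; _+_; _*_; _≤_)
  open import Relation.Binary.PropositionalEquality.Core using (_≡_)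

  -- The counts extracted from a configuration (𝒫, 𝓕) in 𝔽_q^m: Q = q^n points on each flat,
  -- Q · D = q^m points in all, P = |𝒫| and B = q^m − P, F = |𝓕|, I and J the incidences of 𝓕
  -- with 𝒫 and with its complement, S and T the sums of r(x)² over 𝒫 and over its complement.
  record SplitMoments (q Q D P F I : ℕ) : Set where
    field
      B J S T         : ℕ
      cauchy-schwarzᴾ : I * I ≤ P * S
      cauchy-schwarzᴮ : J * J ≤ B * T
      first-moment    : I + J ≡ F * Q
      point-count     : P + B ≡ Q * D
      second-moment   : q * (S + T) + F * Q ≤ F * q * Q + F * F * Q

module AffineCombinations {c ℓ} (K : CommutativeRing c ℓ) where
  open import Data.Fin.Base using (zero; suc)
  open import Data.Nat.Base using (zero; suc)
  open import Data.Product.Base using (_,_)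
  open import Data.Vec.Functional using (Vector; head; tail)

  open CommutativeRing K hiding (zero)
  open AffineGeometry K
  open CommutativeRingSolver K
  open import Algebra.Properties.Ring ring using (x∙y⁻¹≈ε⇒x≈y; x≈y⇒x∙y⁻¹≈ε; +-cancelˡ)
  open import Algebra.Properties.Monoid.Sum +-monoid using (sum-cong-≋)
  open import Relation.Binary.Reasoning.Setoid setoid

  affineComb : ∀ {m} → Point m → Carrier → Point m → Point m → Point m
  affineComb x e y z j = x j + e * (y j - z j)

  param : ∀ {m n} → Flat m n → Point n → Point m
  param F t j = base F j + lincomb t (dir F) j

  param-cong : ∀ {m n} (F : Flat m n) {t u} → t ≈ₚ u → param F t ≈ₚ param F u
  param-cong F t≈u j = +-congˡ (sum-cong-≋ (λ i → *-congʳ (t≈u i)))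

  lincomb-affineComb : ∀ {m n} (s : Point n) e t u (v : Vector (Point m) n) →
                       lincomb (affineComb s e t u) v ≈ₚ affineComb (lincomb s v) e (lincomb t v) (lincomb u v)
  lincomb-affineComb {n = zero}  s e t u v j = solve 2 (λ e z → z := z :+ e :* (z :- z)) refl e 0#
  lincomb-affineComb {m} {suc n} s e t u v j = begin
    (s₀ + e * (t₀ - u₀)) * w + lincomb (affineComb s′ e t′ u′) v′ j
      ≈⟨ +-congˡ (lincomb-affineComb s′ e t′ u′ v′ j) ⟩
    (s₀ + e * (t₀ - u₀)) * w + (lincomb s′ v′ j + e * (lincomb t′ v′ j - lincomb u′ v′ j))
      ≈⟨ solve 8 (λ s₀ t₀ u₀ w e S T U → (s₀ :+ e :* (t₀ :- u₀)) :* w :+ (S :+ e :* (T :- U))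
                      := (s₀ :* w :+ S) :+ e :* ((t₀ :* w :+ T) :- (u₀ :* w :+ U))) refl s₀ t₀ u₀ w e _ _ _ ⟩
    affineComb (lincomb s v) e (lincomb t v) (lincomb u v) j ∎
    where
    s₀ t₀ u₀ w : Carrier
    s₀ = head s; t₀ = head t; u₀ = head u; w = head v j
    s′ t′ u′ : Point n
    s′ = tail s; t′ = tail t; u′ = tail u
    v′ : Vector (Point m) n
    v′ = tail v

  lincomb-sub : ∀ {m n} (t u : Point n) (v : Vector (Point m) n) →
                lincomb (λ i → t i - u i) v ≈ₚ (λ j → lincomb t v j - lincomb u v j)
  lincomb-sub {n = zero}  t u v j = sym (-‿inverseʳ 0#)
  lincomb-sub {n = suc n} t u v j = begin
    (head t - head u) * w + lincomb (λ i → tail t i - tail u i) (tail v) j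
      ≈⟨ +-congˡ (lincomb-sub (tail t) (tail u) (tail v) j) ⟩
    (head t - head u) * w + (lincomb (tail t) (tail v) j - lincomb (tail u) (tail v) j)
      ≈⟨ solve 5 (λ t₀ u₀ w T U → (t₀ :- u₀) :* w :+ (T :- U) := (t₀ :* w :+ T) :- (u₀ :* w :+ U))
               refl (head t) (head u) w _ _ ⟩
    lincomb t v j - lincomb u v j ∎
    where
    w : Carrier
    w = head v j

  param-affineComb : ∀ {m n} (F : Flat m n) s e t u →
                     param F (affineComb s e t u) ≈ₚ affineComb (param F s) e (param F t) (param F u)
  param-affineComb F s e t u j = begin
    base F j + lincomb (affineComb s e t u) (dir F) j   ≈⟨ +-congˡ (lincomb-affineComb s e t u (dir F) j) ⟩
    base F j + (S + e * (T - U))                        ≈⟨ solve 5 (λ b S e T U → b :+ (S :+ e :* (T :- U))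
                                                              := (b :+ S) :+ e :* ((b :+ T) :- (b :+ U)))
                                                              refl (base F j) S e T U ⟩
    affineComb (param F s) e (param F t) (param F u) j  ∎
    where
    S T U : Carrier
    S = lincomb s (dir F) j; T = lincomb t (dir F) j; U = lincomb u (dir F) j

  param-injective : ∀ {m n} (F : Flat m n) {t u} → param F t ≈ₚ param F u → t ≈ₚ u
  param-injective F {t} {u} Ft≈Fu i = x∙y⁻¹≈ε⇒x≈y (t i) (u i) (indep F (λ i → t i - u i) difference≈0 i)
    where
    difference≈0 : lincomb (λ i → t i - u i) (dir F) ≈ₚ (λ _ → 0#)
    difference≈0 j = trans (lincomb-sub t u (dir F) j) (x≈y⇒x∙y⁻¹≈ε (+-cancelˡ (base F j) _ _ (Ft≈Fu j)))

  ∈F-resp-≈ₚ : ∀ {m n} {F : Flat m n} {x y} → x ≈ₚ y → x ∈F F → y ∈F F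
  ∈F-resp-≈ₚ x≈y (t , x≈Ft) = t , λ j → trans (sym (x≈y j)) (x≈Ft j)

  ∈F-affineComb : ∀ {m n} {G : Flat m n} {x y z} e → x ∈F G → y ∈F G → z ∈F G → affineComb x e y z ∈F G
  ∈F-affineComb {G = G} e (s , x≈) (t , y≈) (u , z≈) = affineComb s e t u , λ j →
    trans (+-cong (x≈ j) (*-congˡ (+-cong (y≈ j) (-‿cong (z≈ j))))) (sym (param-affineComb G s e t u j))

  param-∈F-resp : ∀ {m n} (F G : Flat m n) {t u} → t ≈ₚ u → param F t ∈F G → param F u ∈F G
  param-∈F-resp F G t≈u = ∈F-resp-≈ₚ {F = G} (param-cong F t≈u)

  param-∈F-affineComb : ∀ {m n} (F G : Flat m n) {x y z} e →
                        param F x ∈F G → param F y ∈F G → param F z ∈F G → param F (affineComb x e y z) ∈F G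
  param-∈F-affineComb F G e Fx∈G Fy∈G Fz∈G =
    ∈F-resp-≈ₚ {F = G} (λ j → sym (param-affineComb F _ e _ _ j)) (∈F-affineComb {G = G} e Fx∈G Fy∈G Fz∈G)

module FiniteAffineSpace {c ℓ} (K : CommutativeRing c ℓ) {q : ℕ} (FF : IsFiniteField K q) where
  open import Data.Empty using (⊥-elim)
  open import Data.Fin.Base using (zero; suc)
  open import Data.Fin.Properties using (all?)
  open import Data.List.Base using (List; []; _∷_; _++_; length; map; filter; cartesianProductWith)
  open import Data.List.Properties using (length-map; map-cong; filter-≐; map-++; length-++)
  import Data.List.Membership.Setoid as Membership
  open import Data.List.Membership.Setoid.Properties
  open import Data.List.Relation.Binary.Disjoint.Setoid using (Disjoint)
  import Data.List.Relation.Binary.Subset.Setoid as Subset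
  open import Data.List.Relation.Unary.All as All using (All)
  open import Data.List.Relation.Unary.All.Properties using (all-filter)
  open import Data.List.Relation.Unary.AllPairs using (AllPairs; []; _∷_)
  open import Data.List.Relation.Unary.Any as Any using (here; there; any?; satisfied)
  import Data.List.Relation.Unary.Unique.Setoid as UniqueSetoid
  import Data.List.Relation.Unary.Unique.Setoid.Properties as Unique
  open import Data.Nat.Base as ℕ using (ℕ; zero; suc)
  open import Data.Nat.ListAction using (sum)
  open import Data.Nat.ListAction.Properties using (sum-++)
  import Data.Nat.Properties as ℕ
  open import Data.Nat.Tactic.RingSolver using () renaming (solve-∀ to ℕ-solve-∀)
  open import Data.Product.Base using (_,_; proj₁; proj₂; _×_)
  import Data.Vec.Functional as V
  open import Relation.Binary.PropositionalEquality.Core as ≡ using (_≡_)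
  open import Relation.Nullary.Decidable using (Dec; yes; no; ¬?; _×-dec_)
  open import Relation.Nullary.Negation using (¬_)

  open CommutativeRing K using (Carrier; _≈_; setoid; refl; sym; trans)
  open IsFiniteField FF
  open AffineGeometry K
  open AffineCombinations K
  open NaturalSums
  open import Data.Vec.Functional.Relation.Binary.Equality.Setoid setoid using (≋-setoid; ≋-sym)

  open module PointMembership {m : ℕ} = Membership (≋-setoid m) using (_∈_)
  open module PointUnique {m : ℕ} = UniqueSetoid (≋-setoid m) using (Unique)

  points : ∀ m → List (Point m)
  points zero    = V.[] ∷ []
  points (suc m) = cartesianProductWith V._∷_ elements (points m)

  points-unique : ∀ m → Unique (points m)
  points-unique zero    = All.[] ∷ []
  points-unique (suc m) = Unique.cartesianProductWith⁺ setoid (≋-setoid m) (≋-setoid (suc m)) V._∷_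
    (λ x∷u≈y∷v → x∷u≈y∷v zero , λ j → x∷u≈y∷v (suc j)) distinct (points-unique m)

  ∈-points : ∀ {m} (x : Point m) → x ∈ points m
  ∈-points {zero}  x = here (λ ())
  ∈-points {suc m} x = ∈-resp-≈ (≋-setoid (suc m)) head∷tail≈x
    (∈-cartesianProductWith⁺ setoid (≋-setoid m) (≋-setoid (suc m)) ∷-cong
       (complete (V.head x)) (∈-points (V.tail x)))
    where
    ∷-cong : ∀ {a b} {u v : Point m} → a ≈ b → u ≈ₚ v → (a V.∷ u) ≈ₚ (b V.∷ v)
    ∷-cong a≈b u≈v zero    = a≈b
    ∷-cong a≈b u≈v (suc j) = u≈v j
    head∷tail≈x : (V.head x V.∷ V.tail x) ≈ₚ x
    head∷tail≈x zero    = refl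
    head∷tail≈x (suc j) = refl

  length-points : ∀ m → length (points m) ≡ q ℕ.^ m
  length-points zero    = ≡.refl
  length-points (suc m) = ≡.trans (length-cartesianProductWith V._∷_ elements (points m))
                                  (≡.cong₂ ℕ._*_ card (length-points m))

  open module PointSubset {m : ℕ} = Subset (≋-setoid m) using (_⊆_)
  open module PointCounting {m : ℕ} = UniqueListCounting (≋-setoid m)
    using (length-mono-⊆; ⊆-⊇⇒length-≡; ⊆-⊇⇒sum-map-≡)

  module Translates {n} {a} {A : Point n → Set a}
                    (A-resp : ∀ {x y} → x ≈ₚ y → A x → A y)
                    (A-closed : ∀ {x y z} e → A x → A y → A z → A (affineComb x e y z))
                    {t₀ s₁ : Point n} (At₀ : A t₀) (¬As₁ : ¬ A s₁) where
    open CommutativeRing K hiding (zero; Carrier; _≈_; setoid; refl; sym; trans)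
    open CommutativeRingSolver K
    open import Algebra.Properties.Ring ring using (x∙y⁻¹≈ε⇒x≈y; +-cancelʳ)
    open import Relation.Binary.Reasoning.Setoid setoid

    translate : Carrier → Point n → Point n
    translate k a i = a i + k * (s₁ i - t₀ i)

    -- If a + k u ≈ a′ + k′ u for u = s₁ − t₀ and k ≉ k′, then s₁ = t₀ + (k − k′)⁻¹ (a′ − a) would satisfy A.
    translate-collision : ∀ {k k′ a a′} → A a → A a′ → translate k a ≈ₚ translate k′ a′ → k ≈ k′
    translate-collision {k} {k′} {a} {a′} Aa Aa′ collide with k ≟ k′
    ... | yes k≈k′ = k≈k′
    ... | no  k≉k′ = ⊥-elim (¬As₁ (A-resp s₁-as-comb (A-closed e At₀ Aa′ Aa)))
      where
      d : Carrier
      d = k - k′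
      d≉0 : ¬ d ≈ 0#
      d≉0 d≈0 = k≉k′ (x∙y⁻¹≈ε⇒x≈y k k′ d≈0)
      e : Carrier
      e = proj₁ (inverse d d≉0)
      de≈1 : d * e ≈ 1#
      de≈1 = proj₂ (inverse d d≉0)
      difference : ∀ i → a′ i - a i ≈ d * (s₁ i - t₀ i)
      difference i = begin
        a′ i - a i                        ≈⟨ solve 4 (λ a a′ k′ w → a′ :- a := ((a′ :+ k′ :* w) :- k′ :* w) :- a)
                                                 refl (a i) (a′ i) k′ w ⟩
        ((a′ i + k′ * w) - k′ * w) - a i  ≈⟨ +-congʳ (+-congʳ (sym (collide i))) ⟩
        ((a i + k * w) - k′ * w) - a i    ≈⟨ solve 4 (λ a k k′ w → ((a :+ k :* w) :- k′ :* w) :- a := (k :- k′) :* w)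
                                                 refl (a i) k k′ w ⟩
        d * w                             ∎
        where
        w : Carrier
        w = s₁ i - t₀ i
      s₁-as-comb : affineComb t₀ e a′ a ≈ₚ s₁
      s₁-as-comb i = begin
        t₀ i + e * (a′ i - a i)         ≈⟨ +-congˡ (*-congˡ (difference i)) ⟩
        t₀ i + e * (d * (s₁ i - t₀ i))   ≈⟨ solve 4 (λ t s d e → t :+ e :* (d :* (s :- t)) := t :+ (d :* e) :* (s :- t))
                                                refl (t₀ i) (s₁ i) d e ⟩
        t₀ i + (d * e) * (s₁ i - t₀ i)   ≈⟨ +-congˡ (*-congʳ de≈1) ⟩
        t₀ i + 1# * (s₁ i - t₀ i)        ≈⟨ +-congˡ (*-identityˡ _) ⟩
        t₀ i + (s₁ i - t₀ i)             ≈⟨ solve 2 (λ t s → t :+ (s :- t) := s) refl (t₀ i) (s₁ i) ⟩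
        s₁ i                            ∎

    translate-cancel : ∀ {k a a′} → translate k a ≈ₚ translate k a′ → a ≈ₚ a′
    translate-cancel a+ku≈a′+ku i = +-cancelʳ _ _ _ (a+ku≈a′+ku i)

    All-lookup : ∀ {as x} → All A as → x ∈ as → A x
    All-lookup Aas x∈as with All.lookupAny Aas x∈as
    ... | Ay , x≈y = A-resp (≋-sym x≈y) Ay

    translates-unique : ∀ {ks as} → AllPairs (λ k k′ → ¬ k ≈ k′) ks → Unique as → All A as →
                        Unique (cartesianProductWith translate ks as)
    translates-unique {[]}             _             _   _   = []
    translates-unique {k ∷ ks} {as} (k∉ks ∷ ks!) as! Aas =
      Unique.++⁺ (≋-setoid n) (Unique.map⁺ (≋-setoid n) (≋-setoid n) translate-cancel as!)
        (translates-unique ks! as! Aas) disjoint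
      where
      disjoint : Disjoint (≋-setoid n) (map (translate k) as) (cartesianProductWith translate ks as)
      disjoint (v∈map , v∈rest)
        with ∈-map⁻ (≋-setoid n) (≋-setoid n) v∈map
           | ∈-cartesianProductWith⁻ setoid (≋-setoid n) (≋-setoid n) translate ks as v∈rest
      ... | a , a∈as , v≈ka | k′ , a′ , k′∈ks , a′∈as , v≈k′a′ with All.lookupAny k∉ks k′∈ks
      ... | k≉w , k′≈w = k≉w (trans (translate-collision (All-lookup Aas a∈as) (All-lookup Aas a′∈as)
                                      (λ i → trans (sym (v≈ka i)) (v≈k′a′ i))) k′≈w)

    translates-bound : ∀ {as} → Unique as → All A as → q ℕ.* length as ℕ.≤ q ℕ.^ n
    translates-bound {as} as! Aas = ≡.subst₂ ℕ._≤_ length-translates (length-points n)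
      (length-mono-⊆ (translates-unique distinct as! Aas) (λ {y} _ → ∈-points y))
      where
      length-translates : length (cartesianProductWith translate elements as) ≡ q ℕ.* length as
      length-translates = ≡.trans (length-cartesianProductWith translate elements as) (≡.cong (ℕ._* length as) card)

  module Incidence {m n} (mem? : ∀ (x : Point m) (F : Flat m n) → Dec (x ∈F F)) where
    open import Data.Nat.Base using (_+_; _*_; _^_; _≤_; _<_)

    _∈F?_ : ∀ x F → Dec (x ∈F F)
    _∈F?_ = mem?

    points-of : Flat m n → List (Point m)
    points-of F = filter (_∈F? F) (points m)

    ∈-points-of⁺ : ∀ {F x} → x ∈F F → x ∈ points-of F
    ∈-points-of⁺ {F} {x} = ∈-filter⁺ (≋-setoid m) (_∈F? F) (∈F-resp-≈ₚ {F = F}) (∈-points x)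

    ∈-points-of⁻ : ∀ {F x} → x ∈ points-of F → x ∈F F
    ∈-points-of⁻ {F} x∈F = proj₂ (∈-filter⁻ (≋-setoid m) (_∈F? F) (∈F-resp-≈ₚ {F = F}) {xs = points m} x∈F)

    points-of-unique : ∀ F → Unique (points-of F)
    points-of-unique F = Unique.filter⁺ (≋-setoid m) (_∈F? F) (points-unique m)

    flat-size : ∀ F → length (points-of F) ≡ q ^ n
    flat-size F = ≡.trans (⊆-⊇⇒length-≡ (points-of-unique F) image-unique ⊆-image ⊇-image)
                          (≡.trans (length-map (param F) (points n)) (length-points n))
      where
      image-unique : Unique (map (param F) (points n))
      image-unique = Unique.map⁺ (≋-setoid n) (≋-setoid m) (param-injective F) (points-unique n)
      ⊆-image : points-of F ⊆ map (param F) (points n)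
      ⊆-image x∈ with ∈-points-of⁻ x∈
      ... | t , x≈Ft = ∈-resp-≈ (≋-setoid m) (≋-sym x≈Ft)
                         (∈-map⁺ (≋-setoid n) (≋-setoid m) (param-cong F) (∈-points t))
      ⊇-image : map (param F) (points n) ⊆ points-of F
      ⊇-image x∈ with ∈-map⁻ (≋-setoid n) (≋-setoid m) x∈
      ... | t , _ , x≈Ft = ∈-points-of⁺ (t , x≈Ft)

    ⊆⇒SameFlat : ∀ {F G} → (∀ {x} → x ∈F F → x ∈F G) → SameFlat F G
    ⊆⇒SameFlat {F} {G} F⊆G x = F⊆G , G⊆F
      where
      G⊆F : x ∈F G → x ∈F F
      G⊆F x∈G with x ∈F? F
      ... | yes x∈F = x∈F
      ... | no  x∉F = ⊥-elim (ℕ.<-irrefl ≡.refl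
            (≡.subst₂ _<_ (flat-size F) (flat-size G) (length-mono-⊆ (x-fresh ∷ points-of-unique F) x∷F⊆G)))
        where
        x-fresh : All (λ y → ¬ x ≈ₚ y) (points-of F)
        x-fresh = All.map (λ y∈F x≈y → x∉F (∈F-resp-≈ₚ {F = F} (≋-sym x≈y) y∈F))
                          (all-filter (_∈F? F) (points m))
        x∷F⊆G : x ∷ points-of F ⊆ points-of G
        x∷F⊆G (here y≈x)  = ∈-points-of⁺ (∈F-resp-≈ₚ {F = G} (≋-sym y≈x) x∈G)
        x∷F⊆G (there y∈F) = ∈-points-of⁺ (F⊆G (∈-points-of⁻ y∈F))

    points-of-both : Flat m n → Flat m n → List (Point m)
    points-of-both F G = filter (λ x → x ∈F? F ×-dec x ∈F? G) (points m)

    preimage : Flat m n → Flat m n → List (Point n)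
    preimage F G = filter (λ t → param F t ∈F? G) (points n)

    intersection-≤-preimage : ∀ F G → length (points-of-both F G) ≤ length (preimage F G)
    intersection-≤-preimage F G = ≡.subst (length (points-of-both F G) ℕ.≤_) (length-map (param F) (preimage F G))
      (length-mono-⊆ (Unique.filter⁺ (≋-setoid m) (λ x → x ∈F? F ×-dec x ∈F? G) (points-unique m)) ⊆-image)
      where
      both-resp : ∀ {x y} → x ≈ₚ y → x ∈F F × x ∈F G → y ∈F F × y ∈F G
      both-resp x≈y (x∈F , x∈G) = ∈F-resp-≈ₚ {F = F} x≈y x∈F , ∈F-resp-≈ₚ {F = G} x≈y x∈G
      ⊆-image : points-of-both F G ⊆ map (param F) (preimage F G)
      ⊆-image x∈ with proj₂ (∈-filter⁻ (≋-setoid m) (λ x → x ∈F? F ×-dec x ∈F? G) both-resp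
                               {xs = points m} x∈)
      ... | (t , x≈Ft) , x∈G = ∈-resp-≈ (≋-setoid m) (≋-sym x≈Ft)
        (∈-map⁺ (≋-setoid n) (≋-setoid m) (param-cong F)
          (∈-filter⁺ (≋-setoid n) (λ t → param F t ∈F? G) (param-∈F-resp F G) (∈-points t)
            (∈F-resp-≈ₚ {F = G} x≈Ft x∈G)))

    preimage-bound : ∀ {F G} → ¬ SameFlat F G → q * length (preimage F G) ≤ q ^ n
    preimage-bound {F} {G} F≉G with any? (λ t → ¬? (param F t ∈F? G)) (points n)
    ... | yes outside-G = bound-missing (proj₂ (satisfied outside-G))
                            (Unique.filter⁺ (≋-setoid n) (λ t → param F t ∈F? G) (points-unique n))
                            (all-filter (λ t → param F t ∈F? G) (points n))
      where
      bound-missing : ∀ {s₁} → ¬ param F s₁ ∈F G →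
                      ∀ {ts} → Unique ts → All (λ t → param F t ∈F G) ts → q * length ts ≤ q ^ n
      bound-missing _      {[]}    _   _                     =
        ≡.subst (_≤ q ^ n) (≡.sym (ℕ.*-zeroʳ q)) ℕ.z≤n
      bound-missing Fs₁∉G {_ ∷ _} ts! Fts∈G@(Ft₀∈G All.∷ _) =
        Translates.translates-bound (param-∈F-resp F G) (param-∈F-affineComb F G) Ft₀∈G Fs₁∉G ts! Fts∈G
    ... | no all-in-G = ⊥-elim (F≉G (⊆⇒SameFlat {F} {G} F⊆G))
      where
      F⊆G : ∀ {x} → x ∈F F → x ∈F G
      F⊆G (t , x≈Ft) with param F t ∈F? G
      ... | yes Ft∈G = ∈F-resp-≈ₚ {F = G} (≋-sym x≈Ft) Ft∈G
      ... | no  Ft∉G = ⊥-elim (all-in-G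
                         (Any.map (λ t≈u Fu∈G → Ft∉G (param-∈F-resp F G (≋-sym t≈u) Fu∈G)) (∈-points t)))

    intersection-bound : ∀ {F G} → ¬ SameFlat F G → q * length (points-of-both F G) ≤ q ^ n
    intersection-bound {F} {G} F≉G =
      ℕ.≤-trans (ℕ.*-monoʳ-≤ q (intersection-≤-preimage F G)) (preimage-bound {F} {G} F≉G)

    deg : List (Flat m n) → Point m → ℕ
    deg Fs x = length (filter (x ∈F?_) Fs)

    deg-resp : ∀ Fs {x y} → x ≈ₚ y → deg Fs x ≡ deg Fs y
    deg-resp Fs {x} {y} x≈y = ≡.cong length
      (filter-≐ (x ∈F?_) (y ∈F?_) ((λ {F} → ∈F-resp-≈ₚ {F = F} x≈y) , λ {F} → ∈F-resp-≈ₚ {F = F} (≋-sym x≈y))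
        Fs)

    sum-indicator : ∀ F → sum (map (λ x → indicator (x ∈F? F)) (points m)) ≡ q ^ n
    sum-indicator F = ≡.trans (sum-map-indicator (_∈F? F) (points m)) (flat-size F)

    sum-deg : ∀ Fs → sum (map (deg Fs) (points m)) ≡ length Fs * q ^ n
    sum-deg []       = sum-map-0 (points m)
    sum-deg (G ∷ Fs) = begin-equality
      sum (map (deg (G ∷ Fs)) (points m))
        ≡⟨ ≡.cong sum (map-cong (λ x → length-filter-∷ (x ∈F?_) G Fs) (points m)) ⟩
      sum (map (λ x → indicator (x ∈F? G) + deg Fs x) (points m))
        ≡⟨ sum-map-+ _ (deg Fs) (points m) ⟩
      sum (map (λ x → indicator (x ∈F? G)) (points m)) + sum (map (deg Fs) (points m))
        ≡⟨ ≡.cong₂ _+_ (sum-indicator G) (sum-deg Fs) ⟩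
      q ^ n + length Fs * q ^ n
        ∎
      where open ℕ.≤-Reasoning

    sum-indicator*deg : ∀ G Fs → All (λ F → ¬ SameFlat G F) Fs →
      q * sum (map (λ x → indicator (x ∈F? G) * deg Fs x) (points m)) ≤ length Fs * q ^ n
    sum-indicator*deg G []       All.[] = ℕ.≤-reflexive (≡.trans (≡.cong (q ℕ.*_)
      (≡.trans (≡.cong sum (map-cong (λ x → ℕ.*-zeroʳ (indicator (x ∈F? G))) (points m))) (sum-map-0 (points m))))
      (ℕ.*-zeroʳ q))
    sum-indicator*deg G (F ∷ Fs) (G≉F All.∷ G≉Fs) = begin
      q * sum (map (λ x → iG x * deg (F ∷ Fs) x) (points m))     ≡⟨ ≡.cong (q ℕ.*_) split ⟩
      q * (length (points-of-both G F) + X)                      ≡⟨ ℕ.*-distribˡ-+ q _ X ⟩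
      q * length (points-of-both G F) + q * X                  ≤⟨ ℕ.+-mono-≤ (intersection-bound G≉F)
                                                                          (sum-indicator*deg G Fs G≉Fs) ⟩
      q ^ n + length Fs * q ^ n                              ∎
      where
      open ℕ.≤-Reasoning
      iG : Point m → ℕ
      iG x = indicator (x ∈F? G)
      X : ℕ
      X = sum (map (λ x → iG x * deg Fs x) (points m))
      pointwise : ∀ x → iG x * deg (F ∷ Fs) x ≡ indicator (x ∈F? G ×-dec x ∈F? F) + iG x * deg Fs x
      pointwise x = ≡.trans (≡.cong (iG x ℕ.*_) (length-filter-∷ (x ∈F?_) F Fs))
        (≡.trans (ℕ.*-distribˡ-+ (iG x) _ _)
          (≡.cong (_+ iG x * deg Fs x) (indicator-×-dec (x ∈F? G) (x ∈F? F))))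
      split : sum (map (λ x → iG x * deg (F ∷ Fs) x) (points m)) ≡ length (points-of-both G F) + X
      split = ≡.trans (≡.cong sum (map-cong pointwise (points m)))
        (≡.trans (sum-map-+ _ _ (points m))
          (≡.cong (_+ X) (sum-map-indicator (λ x → x ∈F? G ×-dec x ∈F? F) (points m))))

    sum-deg²-∷ : ∀ G Fs →
      sum (map (λ x → deg (G ∷ Fs) x * deg (G ∷ Fs) x) (points m))
        ≡ q ^ n + (2 * sum (map (λ x → indicator (x ∈F? G) * deg Fs x) (points m))
                   + sum (map (λ x → deg Fs x * deg Fs x) (points m)))
    sum-deg²-∷ G Fs = ≡.trans (≡.cong sum (map-cong pointwise (points m)))
      (≡.trans (sum-map-+ iG _ (points m)) (≡.cong₂ _+_ (sum-indicator G)
        (≡.trans (sum-map-+ _ _ (points m)) (≡.cong (_+ _) (sum-map-*ˡ 2 _ (points m))))))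
      where
      iG : Point m → ℕ
      iG x = indicator (x ∈F? G)
      square : ∀ i r → (i + r) * (i + r) ≡ i * i + (2 * (i * r) + r * r)
      square = ℕ-solve-∀
      pointwise : ∀ x → deg (G ∷ Fs) x * deg (G ∷ Fs) x ≡ iG x + (2 * (iG x * deg Fs x) + deg Fs x * deg Fs x)
      pointwise x = ≡.trans (≡.cong (λ k → k * k) (length-filter-∷ (x ∈F?_) G Fs))
        (≡.trans (square (iG x) (deg Fs x))
          (≡.cong (_+ (2 * (iG x * deg Fs x) + deg Fs x * deg Fs x)) (indicator-idem (x ∈F? G))))

    sum-deg² : ∀ Fs → AllPairs (λ F G → ¬ SameFlat F G) Fs →
      q * sum (map (λ x → deg Fs x * deg Fs x) (points m)) + length Fs * q ^ n
        ≤ length Fs * q * q ^ n + length Fs * length Fs * q ^ n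
    sum-deg² []       []           = ℕ.≤-reflexive
      (≡.trans (≡.cong (λ s → q * s + 0) (sum-map-0 (points m))) (≡.cong (_+ 0) (ℕ.*-zeroʳ q)))
    sum-deg² (G ∷ Fs) (G≉Fs ∷ Fs!) = begin
      q * sum (map (λ x → deg (G ∷ Fs) x * deg (G ∷ Fs) x) (points m)) + suc L * Q
        ≡⟨ ≡.cong (λ s → q * s + suc L * Q) (sum-deg²-∷ G Fs) ⟩
      q * (Q + (2 * X + S)) + suc L * Q
        ≡⟨ regroup q Q X S L ⟩
      q * Q + 2 * (q * X) + (q * S + L * Q) + Q
        ≤⟨ ℕ.+-monoˡ-≤ Q (ℕ.+-mono-≤ (ℕ.+-monoʳ-≤ (q * Q) (ℕ.*-monoʳ-≤ 2 (sum-indicator*deg G Fs G≉Fs)))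
                                    (sum-deg² Fs Fs!)) ⟩
      q * Q + 2 * (L * Q) + (L * q * Q + L * L * Q) + Q
        ≡⟨ collect q Q L ⟩
      suc L * q * Q + suc L * suc L * Q
        ∎
      where
      open ℕ.≤-Reasoning
      L Q X S : ℕ
      L = length Fs
      Q = q ^ n
      X = sum (map (λ x → indicator (x ∈F? G) * deg Fs x) (points m))
      S = sum (map (λ x → deg Fs x * deg Fs x) (points m))
      regroup : ∀ q Q X S L → q * (Q + (2 * X + S)) + suc L * Q ≡ q * Q + 2 * (q * X) + (q * S + L * Q) + Q
      regroup = ℕ-solve-∀
      collect : ∀ q Q L → q * Q + 2 * (L * Q) + (L * q * Q + L * L * Q) + Q ≡ suc L * q * Q + suc L * suc L * Q
      collect = ℕ-solve-∀

    module _ (Ps : List (Point m)) (Ps! : Unique Ps) where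

      _∈Ps? : ∀ x → Dec (x ∈ Ps)
      x ∈Ps? = any? (λ y → all? (λ j → x j ≟ y j)) Ps

      outside : List (Point m)
      outside = filter (λ x → ¬? (x ∈Ps?)) (points m)

      Ps++outside-unique : Unique (Ps ++ outside)
      Ps++outside-unique = Unique.++⁺ (≋-setoid m) Ps!
        (Unique.filter⁺ (≋-setoid m) (λ x → ¬? (x ∈Ps?)) (points-unique m))
        λ (v∈Ps , v∈outside) → proj₂ (∈-filter⁻ (≋-setoid m) (λ x → ¬? (x ∈Ps?)) (∉-resp-≈ (≋-setoid m))
                                                 {xs = points m} v∈outside) v∈Ps

      points⊆Ps++outside : points m ⊆ Ps ++ outside
      points⊆Ps++outside {x} _ with x ∈Ps?
      ... | yes x∈Ps = ∈-++⁺ˡ (≋-setoid m) x∈Ps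
      ... | no  x∉Ps = ∈-++⁺ʳ (≋-setoid m) Ps
                         (∈-filter⁺ (≋-setoid m) (λ x → ¬? (x ∈Ps?)) (∉-resp-≈ (≋-setoid m)) (∈-points x) x∉Ps)

      split-sum : ∀ (h : Point m → ℕ) → (∀ {x y} → x ≈ₚ y → h x ≡ h y) →
                  sum (map h (points m)) ≡ sum (map h Ps) + sum (map h outside)
      split-sum h h-resp = ≡.trans
        (⊆-⊇⇒sum-map-≡ h-resp (points-unique m) Ps++outside-unique points⊆Ps++outside (λ {y} _ → ∈-points y))
        (≡.trans (≡.cong sum (map-++ h Ps outside)) (sum-++ (map h Ps) (map h outside)))

      split-length : length (points m) ≡ length Ps + length outside
      split-length = ≡.trans
        (⊆-⊇⇒length-≡ (points-unique m) Ps++outside-unique points⊆Ps++outside (λ {y} _ → ∈-points y))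
        (length-++ Ps)

      split-moments : ∀ {D} → q ^ m ≡ q ^ n * D → ∀ Fs → AllPairs (λ F G → ¬ SameFlat F G) Fs →
                      SplitMoments q (q ^ n) D (length Ps) (length Fs) (incidences mem? Ps Fs)
      split-moments q^m≡QD Fs Fs! = record
        { B               = length outside
        ; J               = sum (map (deg Fs) outside)
        ; S               = sum (map deg² Ps)
        ; T               = sum (map deg² outside)
        ; cauchy-schwarzᴾ = cauchy-schwarz (deg Fs) Ps
        ; cauchy-schwarzᴮ = cauchy-schwarz (deg Fs) outside
        ; first-moment    = ≡.trans (≡.sym (split-sum (deg Fs) (deg-resp Fs))) (sum-deg Fs)
        ; point-count     = ≡.trans (≡.sym split-length) (≡.trans (length-points m) q^m≡QD)
        ; second-moment   = ≡.subst (λ s → q * s + _ ≤ _)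
                              (split-sum deg² (λ x≈y → ≡.cong₂ _*_ (deg-resp Fs x≈y) (deg-resp Fs x≈y)))
                              (sum-deg² Fs Fs!)
        }
        where
        deg² : Point m → ℕ
        deg² x = deg Fs x * deg Fs x

module RationalArithmetic where
  open import Data.Integer.Base as ℤ using ()
  import Data.Integer.Properties as ℤ
  open import Data.Integer.Tactic.RingSolver as ℤ-Solver using ()
  open import Data.Nat.Base as ℕ using (zero; suc)
  import Data.Nat.Properties as ℕ
  open import Data.Nat.Tactic.RingSolver as ℕ-Solver using ()
  open import Data.Product.Base using (_,_)
  open import Data.Rational.Base
  open import Data.Rational.Properties
  import Data.Rational.Unnormalised.Base as ℚᵘ
  import Data.Rational.Unnormalised.Properties as ℚᵘ
  open import Relation.Binary.PropositionalEquality
  open import Data.Rational.Solver using (module +-*-Solver)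
  open +-*-Solver using (solve; _:=_; _:+_; _:*_; _:-_; con)

  -- ℕtoℚ n = n / 1 goes through a gcd normalisation, so the identity is checked on ℚᵘ.
  ℕtoℚ-+ : ∀ m n → ℕtoℚ (m ℕ.+ n) ≡ ℕtoℚ m + ℕtoℚ n
  ℕtoℚ-+ m n = toℚᵘ-injective (begin
    toℚᵘ (ℕtoℚ (m ℕ.+ n))            ≈⟨ toℚᵘ-fromℚᵘ (whole (m ℕ.+ n)) ⟩
    whole (m ℕ.+ n)                  ≈⟨ ℚᵘ.*≡* (trans (cong (ℤ._* ℤ.+ 1) (ℤ.pos-+ m n))
                                                      (cross-multiplied (ℤ.+ m) (ℤ.+ n))) ⟩
    whole m ℚᵘ.+ whole n             ≈⟨ ℚᵘ.+-cong (toℚᵘ-fromℚᵘ (whole m)) (toℚᵘ-fromℚᵘ (whole n)) ⟨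
    toℚᵘ (ℕtoℚ m) ℚᵘ.+ toℚᵘ (ℕtoℚ n)  ≈⟨ toℚᵘ-homo-+ (ℕtoℚ m) (ℕtoℚ n) ⟨
    toℚᵘ (ℕtoℚ m + ℕtoℚ n)           ∎)
    where
    open ℚᵘ.≃-Reasoning
    whole : ℕ.ℕ → ℚᵘ.ℚᵘ
    whole k = ℚᵘ.mkℚᵘ (ℤ.+ k) 0
    cross-multiplied : ∀ a b → (a ℤ.+ b) ℤ.* ℤ.+ 1 ≡ (a ℤ.* ℤ.+ 1 ℤ.+ b ℤ.* ℤ.+ 1) ℤ.* ℤ.+ 1
    cross-multiplied = ℤ-Solver.solve-∀

  ℕtoℚ-* : ∀ m n → ℕtoℚ (m ℕ.* n) ≡ ℕtoℚ m * ℕtoℚ n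
  ℕtoℚ-* zero    n = sym (*-zeroˡ (ℕtoℚ n))
  ℕtoℚ-* (suc m) n = begin
    ℕtoℚ (n ℕ.+ m ℕ.* n)          ≡⟨ ℕtoℚ-+ n (m ℕ.* n) ⟩
    ℕtoℚ n + ℕtoℚ (m ℕ.* n)       ≡⟨ cong (ℕtoℚ n +_) (ℕtoℚ-* m n) ⟩
    ℕtoℚ n + ℕtoℚ m * ℕtoℚ n      ≡⟨ distrib (ℕtoℚ n) (ℕtoℚ m) ⟩
    (1ℚ + ℕtoℚ m) * ℕtoℚ n        ≡⟨ cong (_* ℕtoℚ n) (ℕtoℚ-+ 1 m) ⟨
    ℕtoℚ (suc m) * ℕtoℚ n         ∎
    where
    open ≡-Reasoning
    distrib : ∀ a b → a + b * a ≡ (1ℚ + b) * a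
    distrib = solve 2 (λ a b → a :+ b :* a := ((con 1ℚ) :+ b) :* a) refl

  ℕtoℚ-nonNeg : ∀ n → 0ℚ ≤ ℕtoℚ n
  ℕtoℚ-nonNeg n = nonNegative⁻¹ (ℕtoℚ n) {{normalize-nonNeg n 1}}

  ℕtoℚ-pos : ∀ n .{{_ : ℕ.NonZero n}} → Positive (ℕtoℚ n)
  ℕtoℚ-pos n = normalize-pos n 1

  ℕtoℚ-mono-≤ : ∀ {m n} → m ℕ.≤ n → ℕtoℚ m ≤ ℕtoℚ n
  ℕtoℚ-mono-≤ {m} m≤n with ℕ.m≤n⇒∃[o]m+o≡n m≤n
  ... | k , refl = begin
    ℕtoℚ m             ≡⟨ +-identityʳ (ℕtoℚ m) ⟨
    ℕtoℚ m + 0ℚ        ≤⟨ +-monoʳ-≤ (ℕtoℚ m) (ℕtoℚ-nonNeg k) ⟩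
    ℕtoℚ m + ℕtoℚ k    ≡⟨ ℕtoℚ-+ m k ⟨
    ℕtoℚ (m ℕ.+ k)     ∎
    where open ≤-Reasoning

  ℕtoℚ-∸ : ∀ {m n} → n ℕ.≤ m → ℕtoℚ (m ℕ.∸ n) ≡ ℕtoℚ m - ℕtoℚ n
  ℕtoℚ-∸ {m} {n} n≤m = begin
    ℕtoℚ (m ℕ.∸ n)                     ≡⟨ cancel (ℕtoℚ (m ℕ.∸ n)) (ℕtoℚ n) ⟩
    ℕtoℚ (m ℕ.∸ n) + ℕtoℚ n - ℕtoℚ n   ≡⟨ cong (_- ℕtoℚ n) (ℕtoℚ-+ (m ℕ.∸ n) n) ⟨
    ℕtoℚ (m ℕ.∸ n ℕ.+ n) - ℕtoℚ n      ≡⟨ cong (λ k → ℕtoℚ k - ℕtoℚ n) (ℕ.m∸n+n≡m n≤m) ⟩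
    ℕtoℚ m - ℕtoℚ n                    ∎
    where
    open ≡-Reasoning
    cancel : ∀ a b → a ≡ a + b - b
    cancel = solve 2 (λ a b → a := a :+ b :- b) refl

  *-monoˡ-≤-0≤ : ∀ {r p q} → 0ℚ ≤ r → p ≤ q → r * p ≤ r * q
  *-monoˡ-≤-0≤ {r} 0≤r = *-monoˡ-≤-nonNeg r {{nonNegative 0≤r}}

  *-monoʳ-≤-0≤ : ∀ {r p q} → 0ℚ ≤ r → p ≤ q → p * r ≤ q * r
  *-monoʳ-≤-0≤ {r} 0≤r = *-monoʳ-≤-nonNeg r {{nonNegative 0≤r}}

  *-nonNeg : ∀ {p q} → 0ℚ ≤ p → 0ℚ ≤ q → 0ℚ ≤ p * q
  *-nonNeg {p} 0≤p 0≤q = subst (_≤ p * _) (*-zeroʳ p) (*-monoˡ-≤-0≤ 0≤p 0≤q)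

  *-÷ℕ-inverse : ∀ x k .{{_ : ℕ.NonZero k}} → ℕtoℚ k * (x ÷ℕ k) ≡ x
  *-÷ℕ-inverse x (suc k) = begin
    ℕtoℚ (suc k) * (x * r)     ≡⟨ rearrange (ℕtoℚ (suc k)) x r ⟩
    x * (ℕtoℚ (suc k) * r)     ≡⟨ cong (x *_) k*r≡1 ⟩
    x * 1ℚ                     ≡⟨ *-identityʳ x ⟩
    x                          ∎
    where
    open ≡-Reasoning
    r : ℚ
    r = ℤ.+ 1 / suc k
    rearrange : ∀ a b c → a * (b * c) ≡ b * (a * c)
    rearrange = solve 3 (λ a b c → a :* (b :* c) := b :* (a :* c)) refl
    unit : ∀ k → k ℕ.* 1 ℕ.* 1 ≡ k ℕ.+ 0 ℕ.+ 0
    unit = ℕ-Solver.solve-∀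
    k*r≡1 : ℕtoℚ (suc k) * r ≡ 1ℚ
    k*r≡1 = toℚᵘ-injective (ℚᵘ.≃-trans (toℚᵘ-homo-* (ℕtoℚ (suc k)) r)
      (ℚᵘ.≃-trans (ℚᵘ.*-cong (toℚᵘ-fromℚᵘ (ℚᵘ.mkℚᵘ (ℤ.+ suc k) 0)) (toℚᵘ-fromℚᵘ (ℚᵘ.mkℚᵘ (ℤ.+ 1) k)))
                  (ℚᵘ.*≡* (cong (λ n → ℤ.+ suc n) (unit k)))))

  *-÷ℕ-assoc : ∀ x y k → (x * y) ÷ℕ k ≡ x * (y ÷ℕ k)
  *-÷ℕ-assoc x y zero    = sym (*-zeroʳ x)
  *-÷ℕ-assoc x y (suc k) = *-assoc x y _

  ÷ℕ-nonNeg : ∀ {x} k → 0ℚ ≤ x → 0ℚ ≤ x ÷ℕ k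
  ÷ℕ-nonNeg zero    _   = ≤-refl
  ÷ℕ-nonNeg (suc k) 0≤x = *-nonNeg 0≤x (nonNegative⁻¹ _ {{normalize-nonNeg 1 (suc k)}})

  p≤q⇒0≤q-p : ∀ {p q} → p ≤ q → 0ℚ ≤ q - p
  p≤q⇒0≤q-p {p} {q} p≤q = subst (_≤ q - p) (+-inverseʳ p) (+-monoˡ-≤ (- p) p≤q)

  p+q≤r⇒p≤r-q : ∀ {p q r} → p + q ≤ r → p ≤ r - q
  p+q≤r⇒p≤r-q {p} {q} {r} p+q≤r = subst (_≤ r - q) (cancel p q) (+-monoˡ-≤ (- q) p+q≤r)
    where
    cancel : ∀ p q → p + q - q ≡ p
    cancel = solve 2 (λ p q → p :+ q :- q := p) refl

  0≤r⇒p-r≤p : ∀ {p r} → 0ℚ ≤ r → p - r ≤ p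
  0≤r⇒p-r≤p {p} 0≤r = subst (p - _ ≤_) (+-identityʳ p) (+-monoʳ-≤ p (neg-antimono-≤ 0≤r))

  -- Once J = c (P + B) − I, the right-hand side exceeds the left by B (P S − I²) + P (B T − J²).
  two-part-variance : ∀ {P B I J S T c} → 0ℚ ≤ P → 0ℚ ≤ B → I * I ≤ P * S → J * J ≤ B * T →
                      I + J ≡ c * (P + B) →
                      (P + B) * ((I - P * c) * (I - P * c)) ≤ P * B * (S + T - c * (I + J))
  two-part-variance {P} {B} {I} {J} {S} {T} {c} 0≤P 0≤B I²≤PS J²≤BT I+J≡ =
    complement-form (trans (solve-J I J) (cong (_- I) I+J≡)) J²≤BT
    where
    solve-J : ∀ I J → J ≡ (I + J) - I
    solve-J = solve 2 (λ I J → J := (I :+ J) :- I) refl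
    complement-form : ∀ {J′} → J′ ≡ c * (P + B) - I → J′ * J′ ≤ B * T →
                      (P + B) * ((I - P * c) * (I - P * c)) ≤ P * B * (S + T - c * (I + J′))
    complement-form refl J²≤BT = begin
      (P + B) * Δ²                                      ≡⟨ +-identityˡ _ ⟨
      0ℚ + (P + B) * Δ²                                 ≤⟨ +-monoˡ-≤ ((P + B) * Δ²) 0≤gaps ⟩
      (B * (P * S - I * I) + P * (B * T - J₀ * J₀)) + (P + B) * Δ²
                                                        ≡⟨ identity P B I S T c ⟩
      P * B * (S + T - c * (I + J₀))                    ∎
      where
      open ≤-Reasoning
      Δ² J₀ : ℚ
      Δ² = (I - P * c) * (I - P * c)
      J₀ = c * (P + B) - I
      0≤gaps : 0ℚ ≤ B * (P * S - I * I) + P * (B * T - J₀ * J₀)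
      0≤gaps = subst (_≤ B * (P * S - I * I) + P * (B * T - J₀ * J₀)) (+-identityʳ 0ℚ)
                 (+-mono-≤ (*-nonNeg 0≤B (p≤q⇒0≤q-p I²≤PS)) (*-nonNeg 0≤P (p≤q⇒0≤q-p J²≤BT)))
      identity : ∀ P B I S T c →
        (B * (P * S - I * I) + P * (B * T - (c * (P + B) - I) * (c * (P + B) - I)))
          + (P + B) * ((I - P * c) * (I - P * c))
        ≡ P * B * (S + T - c * (I + (c * (P + B) - I)))
      identity = solve 6 (λ P B I S T c →
        (B :* (P :* S :- I :* I) :+ P :* (B :* T :- (c :* (P :+ B) :- I) :* (c :* (P :+ B) :- I)))
          :+ (P :+ B) :* ((I :- P :* c) :* (I :- P :* c))
        := P :* B :* (S :+ T :- c :* (I :+ (c :* (P :+ B) :- I)))) refl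

module MomentBounds where
  import Data.Nat.Base as ℕ
  import Data.Nat.Properties as ℕ
  open import Data.Rational.Base
  open import Data.Rational.Properties
  open import Data.Rational.Solver using (module +-*-Solver)
  open +-*-Solver using (solve; _:=_; _:+_; _:*_; _:-_; con)
  open import Relation.Binary.PropositionalEquality using (_≡_; refl; sym; trans; cong; cong₂; subst; subst₂; module ≡-Reasoning)
  open RationalArithmetic

  m*n≤m*[m+n∸1] : ∀ m n → m ℕ.* n ℕ.≤ m ℕ.* (m ℕ.+ n ℕ.∸ 1)
  m*n≤m*[m+n∸1] ℕ.zero    n = ℕ.z≤n
  m*n≤m*[m+n∸1] (ℕ.suc m) n = ℕ.*-monoʳ-≤ (ℕ.suc m) (ℕ.m≤n+m n m)

  module _ {q Q D P F I : ℕ} (M : SplitMoments q Q D P F I) where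
    open SplitMoments M

    private
      q′ Q′ D′ P′ F′ I′ B′ J′ S′ T′ : ℚ
      q′ = ℕtoℚ q; Q′ = ℕtoℚ Q; D′ = ℕtoℚ D; P′ = ℕtoℚ P; F′ = ℕtoℚ F; I′ = ℕtoℚ I
      B′ = ℕtoℚ B; J′ = ℕtoℚ J; S′ = ℕtoℚ S; T′ = ℕtoℚ T
      0≤q : 0ℚ ≤ q′
      0≤q = ℕtoℚ-nonNeg q
      0≤P : 0ℚ ≤ P′
      0≤P = ℕtoℚ-nonNeg P
      0≤B : 0ℚ ≤ B′
      0≤B = ℕtoℚ-nonNeg B
      0≤F : 0ℚ ≤ F′
      0≤F = ℕtoℚ-nonNeg F

      ℕtoℚ-*³ : ∀ a b c → ℕtoℚ (a ℕ.* b ℕ.* c) ≡ ℕtoℚ a * ℕtoℚ b * ℕtoℚ c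
      ℕtoℚ-*³ a b c = trans (ℕtoℚ-* (a ℕ.* b) c) (cong (_* ℕtoℚ c) (ℕtoℚ-* a b))

      ℕtoℚ-square-≤ : ∀ a b c → a ℕ.* a ℕ.≤ b ℕ.* c → ℕtoℚ a * ℕtoℚ a ≤ ℕtoℚ b * ℕtoℚ c
      ℕtoℚ-square-≤ a b c a²≤bc = subst₂ _≤_ (ℕtoℚ-* a a) (ℕtoℚ-* b c) (ℕtoℚ-mono-≤ a²≤bc)

      first-momentℚ : I′ + J′ ≡ F′ * Q′
      first-momentℚ = trans (sym (ℕtoℚ-+ I J)) (trans (cong ℕtoℚ first-moment) (ℕtoℚ-* F Q))

      point-countℚ : P′ + B′ ≡ Q′ * D′
      point-countℚ = trans (sym (ℕtoℚ-+ P B)) (trans (cong ℕtoℚ point-count) (ℕtoℚ-* Q D))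

      second-momentℚ : q′ * (S′ + T′) ≤ F′ * q′ * Q′ + F′ * F′ * Q′ - F′ * Q′
      second-momentℚ = p+q≤r⇒p≤r-q (subst₂ _≤_ lhs rhs (ℕtoℚ-mono-≤ second-moment))
        where
        lhs : ℕtoℚ (q ℕ.* (S ℕ.+ T) ℕ.+ F ℕ.* Q) ≡ q′ * (S′ + T′) + F′ * Q′
        lhs = trans (ℕtoℚ-+ (q ℕ.* (S ℕ.+ T)) (F ℕ.* Q))
                (cong₂ _+_ (trans (ℕtoℚ-* q (S ℕ.+ T)) (cong (q′ *_) (ℕtoℚ-+ S T))) (ℕtoℚ-* F Q))
        rhs : ℕtoℚ (F ℕ.* q ℕ.* Q ℕ.+ F ℕ.* F ℕ.* Q) ≡ F′ * q′ * Q′ + F′ * F′ * Q′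
        rhs = trans (ℕtoℚ-+ (F ℕ.* q ℕ.* Q) (F ℕ.* F ℕ.* Q)) (cong₂ _+_ (ℕtoℚ-*³ F q Q) (ℕtoℚ-*³ F F Q))

      first-moment-mean : .{{_ : ℕ.NonZero D}} → I′ + J′ ≡ (F′ ÷ℕ D) * (P′ + B′)
      first-moment-mean = begin
        I′ + J′                    ≡⟨ first-momentℚ ⟩
        F′ * Q′                    ≡⟨ cong (_* Q′) (*-÷ℕ-inverse F′ D) ⟨
        D′ * (F′ ÷ℕ D) * Q′        ≡⟨ regroup D′ (F′ ÷ℕ D) Q′ ⟩
        (F′ ÷ℕ D) * (Q′ * D′)      ≡⟨ cong ((F′ ÷ℕ D) *_) point-countℚ ⟨
        (F′ ÷ℕ D) * (P′ + B′)      ∎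
        where
        open ≡-Reasoning
        regroup : ∀ D c Q → D * c * Q ≡ c * (Q * D)
        regroup = solve 3 (λ D c Q → D :* c :* Q := c :* (Q :* D)) refl

    variance-bound : .{{_ : ℕ.NonZero Q}} .{{_ : ℕ.NonZero D}} →
                     let c = F′ ÷ℕ D; Δ = I′ - P′ * c in
                     q′ * D′ * (Δ * Δ) ≤ P′ * B′ * F′ * (q′ - 1ℚ + F′ - q′ * c)
    variance-bound = *-cancelˡ-≤-pos Q′ {{ℕtoℚ-pos Q}} (begin
      Q′ * (q′ * D′ * Δ²)                               ≡⟨ regroup-Q Q′ q′ D′ Δ² ⟩
      q′ * (Q′ * D′ * Δ²)                               ≡⟨ cong (λ x → q′ * (x * Δ²)) point-countℚ ⟨
      q′ * ((P′ + B′) * Δ²)                             ≤⟨ *-monoˡ-≤-0≤ 0≤q two-parts ⟩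
      q′ * (P′ * B′ * (S′ + T′ - c * (I′ + J′)))         ≡⟨ cong (λ x → q′ * (P′ * B′ * (S′ + T′ - c * x)))
                                                              first-momentℚ ⟩
      q′ * (P′ * B′ * (S′ + T′ - c * (F′ * Q′)))         ≡⟨ regroup-q q′ P′ B′ S′ T′ c F′ Q′ ⟩
      P′ * B′ * (q′ * (S′ + T′) - q′ * c * F′ * Q′)      ≤⟨ *-monoˡ-≤-0≤ (*-nonNeg 0≤P 0≤B)
                                                              (+-monoˡ-≤ (- (q′ * c * F′ * Q′)) second-momentℚ) ⟩
      P′ * B′ * (F′ * q′ * Q′ + F′ * F′ * Q′ - F′ * Q′ - q′ * c * F′ * Q′)
                                                        ≡⟨ factor-Q P′ B′ F′ q′ Q′ c ⟩
      Q′ * (P′ * B′ * F′ * (q′ - 1ℚ + F′ - q′ * c))      ∎)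
      where
      open ≤-Reasoning
      c Δ² : ℚ
      c = F′ ÷ℕ D
      Δ² = (I′ - P′ * c) * (I′ - P′ * c)
      regroup-Q : ∀ Q q D x → Q * (q * D * x) ≡ q * (Q * D * x)
      regroup-Q = solve 4 (λ Q q D x → Q :* (q :* D :* x) := q :* (Q :* D :* x)) refl
      regroup-q : ∀ q P B S T c F Q → q * (P * B * (S + T - c * (F * Q))) ≡ P * B * (q * (S + T) - q * c * F * Q)
      regroup-q = solve 8 (λ q P B S T c F Q → q :* (P :* B :* (S :+ T :- c :* (F :* Q)))
                                            := P :* B :* (q :* (S :+ T) :- q :* c :* F :* Q)) refl
      factor-Q : ∀ P B F q Q c →
                 P * B * (F * q * Q + F * F * Q - F * Q - q * c * F * Q) ≡ Q * (P * B * F * (q - 1ℚ + F - q * c))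
      factor-Q = solve 6 (λ P B F q Q c → P :* B :* (F :* q :* Q :+ F :* F :* Q :- F :* Q :- q :* c :* F :* Q)
                                        := Q :* (P :* B :* F :* (q :- con 1ℚ :+ F :- q :* c))) refl
      two-parts : (P′ + B′) * Δ² ≤ P′ * B′ * (S′ + T′ - c * (I′ + J′))
      two-parts = two-part-variance {P′} {B′} {I′} {J′} {S′} {T′} {c} 0≤P 0≤B
                    (ℕtoℚ-square-≤ I P S cauchy-schwarzᴾ) (ℕtoℚ-square-≤ J B T cauchy-schwarzᴮ) first-moment-mean

    P*B≤P*[Q*D-1] : .{{_ : ℕ.NonZero Q}} .{{_ : ℕ.NonZero D}} → P′ * B′ ≤ P′ * (Q′ * D′ - 1ℚ)
    P*B≤P*[Q*D-1] = begin
      P′ * B′                              ≡⟨ ℕtoℚ-* P B ⟨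
      ℕtoℚ (P ℕ.* B)                       ≤⟨ ℕtoℚ-mono-≤ (m*n≤m*[m+n∸1] P B) ⟩
      ℕtoℚ (P ℕ.* (P ℕ.+ B ℕ.∸ 1))          ≡⟨ ℕtoℚ-* P (P ℕ.+ B ℕ.∸ 1) ⟩
      P′ * ℕtoℚ (P ℕ.+ B ℕ.∸ 1)             ≡⟨ cong (λ n → P′ * ℕtoℚ (n ℕ.∸ 1)) point-count ⟩
      P′ * ℕtoℚ (Q ℕ.* D ℕ.∸ 1)             ≡⟨ cong (P′ *_) (ℕtoℚ-∸ 1≤QD) ⟩
      P′ * (ℕtoℚ (Q ℕ.* D) - 1ℚ)            ≡⟨ cong (λ x → P′ * (x - 1ℚ)) (ℕtoℚ-* Q D) ⟩
      P′ * (Q′ * D′ - 1ℚ)                   ∎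
      where
      open ≤-Reasoning
      1≤QD : 1 ℕ.≤ Q ℕ.* D
      1≤QD = ℕ.>-nonZero⁻¹ (Q ℕ.* D) {{ℕ.m*n≢0 Q D}}

    private
      drop-negative : ∀ {c} → 0ℚ ≤ c → q′ - 1ℚ + F′ - q′ * c ≤ F′ + q′
      drop-negative {c} 0≤c = subst (_≤ F′ + q′) (rearrange q′ F′ c) (0≤r⇒p-r≤p 0≤1+qc)
        where
        rearrange : ∀ q F c → (F + q) - (1ℚ + q * c) ≡ q - 1ℚ + F - q * c
        rearrange = solve 3 (λ q F c → (F :+ q) :- (con 1ℚ :+ q :* c) := q :- con 1ℚ :+ F :- q :* c) refl
        0≤1+qc : 0ℚ ≤ 1ℚ + q′ * c
        0≤1+qc = subst (_≤ 1ℚ + q′ * c) (+-identityʳ 0ℚ) (+-mono-≤ (ℕtoℚ-nonNeg 1) (*-nonNeg 0≤q 0≤c))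

    incidence-bound : .{{_ : ℕ.NonZero q}} .{{_ : ℕ.NonZero Q}} .{{_ : ℕ.NonZero D}} → ∀ {G} → 1ℚ ≤ G →
                      let Δ = I′ - (P′ * F′) ÷ℕ D in
                      Δ * Δ ≤ Q′ * (P′ * F′) * ((F′ ÷ℕ q) + G)
    incidence-bound {G = G} 1≤G =
      *-cancelˡ-≤-pos (q′ * D′) {{pos*pos⇒pos q′ {{ℕtoℚ-pos q}} D′ {{ℕtoℚ-pos D}}}} (begin
        q′ * D′ * (Δ * Δ)                          ≡⟨ cong (λ x → q′ * D′ * ((I′ - x) * (I′ - x)))
                                                         (*-÷ℕ-assoc P′ F′ D) ⟩
        q′ * D′ * ((I′ - P′ * c) * (I′ - P′ * c))  ≤⟨ variance-bound ⟩
        P′ * B′ * F′ * (q′ - 1ℚ + F′ - q′ * c)      ≤⟨ *-monoˡ-≤-0≤ (*-nonNeg (*-nonNeg 0≤P 0≤B) 0≤F) (drop-negative (÷ℕ-nonNeg D 0≤F)) ⟩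
        P′ * B′ * F′ * (F′ + q′)                   ≤⟨ *-monoʳ-≤-0≤ 0≤F+q (*-monoʳ-≤-0≤ 0≤F (*-monoˡ-≤-0≤ 0≤P B≤QD)) ⟩
        P′ * (Q′ * D′) * F′ * (F′ + q′)            ≤⟨ *-monoˡ-≤-0≤ 0≤PQDF (+-monoʳ-≤ F′ q≤qG) ⟩
        P′ * (Q′ * D′) * F′ * (F′ + q′ * G)        ≡⟨ cong (λ x → P′ * (Q′ * D′) * F′ * (x + q′ * G))
                                                         (*-÷ℕ-inverse F′ q) ⟨
        P′ * (Q′ * D′) * F′ * (q′ * (F′ ÷ℕ q) + q′ * G)
                                                   ≡⟨ regroup q′ D′ Q′ P′ F′ (F′ ÷ℕ q) G ⟩
        q′ * D′ * (Q′ * (P′ * F′) * ((F′ ÷ℕ q) + G))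
                                                   ∎)
      where
      open ≤-Reasoning
      c Δ : ℚ
      c = F′ ÷ℕ D
      Δ = I′ - (P′ * F′) ÷ℕ D
      B≤QD : B′ ≤ Q′ * D′
      B≤QD = subst (B′ ≤_) point-countℚ (subst (_≤ P′ + B′) (+-identityˡ B′) (+-monoˡ-≤ B′ 0≤P))
      0≤F+q : 0ℚ ≤ F′ + q′
      0≤F+q = subst (_≤ F′ + q′) (+-identityʳ 0ℚ) (+-mono-≤ 0≤F 0≤q)
      0≤PQDF : 0ℚ ≤ P′ * (Q′ * D′) * F′
      0≤PQDF = *-nonNeg (*-nonNeg 0≤P (*-nonNeg (ℕtoℚ-nonNeg Q) (ℕtoℚ-nonNeg D))) 0≤F
      q≤qG : q′ ≤ q′ * G
      q≤qG = subst (_≤ q′ * G) (*-identityʳ q′) (*-monoˡ-≤-0≤ 0≤q 1≤G)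
      regroup : ∀ q D Q P F x G → P * (Q * D) * F * (q * x + q * G) ≡ q * D * (Q * (P * F) * (x + G))
      regroup = solve 7 (λ q D Q P F x G → P :* (Q :* D) :* F :* (q :* x :+ q :* G)
                                        := q :* D :* (Q :* (P :* F) :* (x :+ G))) refl

  incidence-bound-hyperplane : ∀ {q Q P F I} (M : SplitMoments q Q q P F I) .{{_ : ℕ.NonZero q}} .{{_ : ℕ.NonZero Q}} →
                               ∀ {G} → G * (ℕtoℚ q - 1ℚ) ≡ ℕtoℚ Q * ℕtoℚ q - 1ℚ →
                               let Δ = ℕtoℚ I - (ℕtoℚ P * ℕtoℚ F) ÷ℕ q
                                   E = 1ℚ - (1ℚ ÷ℕ q) in
                               Δ * Δ ≤ ℕtoℚ Q * (E * E) * (ℕtoℚ P * ℕtoℚ F) * (G ÷ℕ Q)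
  incidence-bound-hyperplane {q} {Q} {P} {F} {I} M {G} G[q-1]≡Qq-1 =
    *-cancelˡ-≤-pos (q′ * q′) {{pos*pos⇒pos q′ {{ℕtoℚ-pos q}} q′ {{ℕtoℚ-pos q}}}} (begin
      q′ * q′ * (Δ * Δ)
        ≡⟨ cong (λ x → q′ * q′ * ((I′ - x) * (I′ - x))) (*-÷ℕ-assoc P′ F′ q) ⟩
      q′ * q′ * ((I′ - P′ * c) * (I′ - P′ * c))
        ≤⟨ variance-bound M ⟩
      P′ * B′ * F′ * (q′ - 1ℚ + F′ - q′ * c)
        ≡⟨ cong (λ x → P′ * B′ * F′ * (q′ - 1ℚ + F′ - x)) (*-÷ℕ-inverse F′ q) ⟩
      P′ * B′ * F′ * (q′ - 1ℚ + F′ - F′)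
        ≡⟨ cancel-F P′ B′ F′ q′ ⟩
      P′ * B′ * (F′ * (q′ - 1ℚ))
        ≤⟨ *-monoʳ-≤-0≤ 0≤F[q-1] (P*B≤P*[Q*D-1] M) ⟩
      P′ * (Q′ * q′ - 1ℚ) * (F′ * (q′ - 1ℚ))
        ≡⟨ cong (λ x → P′ * x * (F′ * (q′ - 1ℚ))) G[q-1]≡Qq-1 ⟨
      P′ * (G * (q′ - 1ℚ)) * (F′ * (q′ - 1ℚ))
        ≡⟨ cong₂ (λ x y → P′ * (x * (q′ - y)) * (F′ * (q′ - y))) (*-÷ℕ-inverse G Q) (*-÷ℕ-inverse 1ℚ q) ⟨
      P′ * (Q′ * g * (q′ - q′ * u)) * (F′ * (q′ - q′ * u))
        ≡⟨ regroup P′ Q′ g q′ u F′ ⟩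
      q′ * q′ * (Q′ * (E * E) * (P′ * F′) * g)
        ∎)
    where
    open ≤-Reasoning
    open SplitMoments M using (B)
    q′ Q′ P′ F′ I′ B′ c Δ u g E : ℚ
    q′ = ℕtoℚ q; Q′ = ℕtoℚ Q; P′ = ℕtoℚ P; F′ = ℕtoℚ F; I′ = ℕtoℚ I; B′ = ℕtoℚ B
    c = F′ ÷ℕ q
    Δ = I′ - (P′ * F′) ÷ℕ q
    u = 1ℚ ÷ℕ q
    g = G ÷ℕ Q
    E = 1ℚ - u
    0≤F[q-1] : 0ℚ ≤ F′ * (q′ - 1ℚ)
    0≤F[q-1] = *-nonNeg (ℕtoℚ-nonNeg F) (p≤q⇒0≤q-p (ℕtoℚ-mono-≤ (ℕ.>-nonZero⁻¹ q)))
    cancel-F : ∀ P B F q → P * B * F * (q - 1ℚ + F - F) ≡ P * B * (F * (q - 1ℚ))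
    cancel-F = solve 4 (λ P B F q → P :* B :* F :* (q :- con 1ℚ :+ F :- F) := P :* B :* (F :* (q :- con 1ℚ))) refl
    regroup : ∀ P Q g q u F →
              P * (Q * g * (q - q * u)) * (F * (q - q * u)) ≡ q * q * (Q * ((1ℚ - u) * (1ℚ - u)) * (P * F) * g)
    regroup = solve 6 (λ P Q g q u F → P :* (Q :* g :* (q :- q :* u)) :* (F :* (q :- q :* u))
                                    := q :* q :* (Q :* ((con 1ℚ :- u) :* (con 1ℚ :- u)) :* (P :* F) :* g)) refl

module GaussianBinomial where
  open import Data.List.Base using ([]; _∷_; length; map; upTo)
  open import Data.List.Properties using (length-upTo)
  open import Data.List.Relation.Unary.All as All using (All; []; _∷_)
  open import Data.List.Relation.Unary.All.Properties using (all-upTo; map⁺)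
  open import Data.Nat.Base as ℕ using (suc; _+_; _*_; _^_; _∸_; _<_; NonZero)
  open import Data.Nat.ListAction using (product)
  open import Data.Nat.ListAction.Properties using (product≢0)
  import Data.Nat.Properties as ℕ
  open import Data.Nat.Tactic.RingSolver using (solve-∀)
  open import Data.Rational.Base as ℚ using (ℚ; 1ℚ; _≤_)
  import Data.Rational.Properties as ℚ
  open import Relation.Binary.PropositionalEquality
  open RationalArithmetic

  product-scale-≤ : ∀ {a} {A : Set a} {c} (f g : A → ℕ) xs → All (λ x → c * g x ℕ.≤ f x) xs →
                    c ^ length xs * product (map g xs) ℕ.≤ product (map f xs)
  product-scale-≤ f g []       []           = ℕ.≤-refl
  product-scale-≤ {c = c} f g (x ∷ xs) (cg≤f ∷ cgs≤fs) = begin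
    c * c ^ length xs * (g x * product (map g xs))   ≡⟨ interchange c (c ^ length xs) (g x) _ ⟩
    c * g x * (c ^ length xs * product (map g xs))   ≤⟨ ℕ.*-mono-≤ cg≤f (product-scale-≤ f g xs cgs≤fs) ⟩
    f x * product (map f xs)                         ∎
    where
    open ℕ.≤-Reasoning
    interchange : ∀ a b c d → a * b * (c * d) ≡ a * c * (b * d)
    interchange = solve-∀

  module _ {q : ℕ} (2≤q : 2 ℕ.≤ q) where

    private
      instance
        q≢0 : NonZero q
        q≢0 = ℕ.>-nonZero (ℕ.≤-trans (ℕ.s≤s ℕ.z≤n) 2≤q)

      1≤q^[1+e]∸1 : ∀ e → 1 ℕ.≤ q ^ suc e ∸ 1
      1≤q^[1+e]∸1 e = ℕ.∸-monoˡ-≤ 1 (ℕ.≤-trans 2≤q (ℕ.m≤m*n q (q ^ e) {{ℕ.m^n≢0 q e}}))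

      denominator-factor-≢0 : ∀ {d i} → i < d → NonZero (q ^ (d ∸ i) ∸ 1)
      denominator-factor-≢0 {d} {i} i<d with d ∸ i | ℕ.m<n⇒0<n∸m i<d
      ... | suc e | _ = ℕ.>-nonZero (1≤q^[1+e]∸1 e)

      numerator-factor-≥ : ∀ n {d i} → i ℕ.≤ d → q ^ n * (q ^ (d ∸ i) ∸ 1) ℕ.≤ q ^ (n + d ∸ i) ∸ 1
      numerator-factor-≥ n {d} {i} i≤d = begin
        q ^ n * (q ^ (d ∸ i) ∸ 1)        ≡⟨ ℕ.*-distribˡ-∸ (q ^ n) (q ^ (d ∸ i)) 1 ⟩
        q ^ n * q ^ (d ∸ i) ∸ q ^ n * 1  ≤⟨ ℕ.∸-monoʳ-≤ (q ^ n * q ^ (d ∸ i))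
                                               (ℕ.≤-trans (ℕ.m^n>0 q n) (ℕ.≤-reflexive (sym (ℕ.*-identityʳ (q ^ n))))) ⟩
        q ^ n * q ^ (d ∸ i) ∸ 1          ≡⟨ cong (_∸ 1) (ℕ.^-distribˡ-+-* q n (d ∸ i)) ⟨
        q ^ (n + (d ∸ i)) ∸ 1            ≡⟨ cong (λ k → q ^ k ∸ 1) (ℕ.+-∸-assoc n i≤d) ⟨
        q ^ (n + d ∸ i) ∸ 1              ∎
        where open ℕ.≤-Reasoning

    gaussBinom-≥1 : ∀ n d → 1ℚ ≤ gaussBinom q (n + d) d ÷ℕ (q ^ (d * n))
    gaussBinom-≥1 n d = ℚ.*-cancelˡ-≤-pos (den′ ℚ.* K′) {{ℚ.pos*pos⇒pos den′ {{ℕtoℚ-pos den}} K′ {{ℕtoℚ-pos K}}}}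
     (begin
      den′ ℚ.* K′ ℚ.* 1ℚ            ≡⟨ trans (ℚ.*-identityʳ _) (trans (ℚ.*-comm den′ K′) (sym (ℕtoℚ-* K den))) ⟩
      ℕtoℚ (K * den)                ≤⟨ ℕtoℚ-mono-≤ K*den≤num ⟩
      ℕtoℚ num                      ≡⟨ *-÷ℕ-inverse (ℕtoℚ num) den ⟨
      den′ ℚ.* (ℕtoℚ num ÷ℕ den)    ≡⟨ cong (den′ ℚ.*_) (*-÷ℕ-inverse _ K) ⟨
      den′ ℚ.* (K′ ℚ.* G)           ≡⟨ ℚ.*-assoc den′ K′ G ⟨
      den′ ℚ.* K′ ℚ.* G             ∎)
      where
      open ℚ.≤-Reasoning
      num den K : ℕ
      num = product (map (λ i → q ^ (n + d ∸ i) ∸ 1) (upTo d))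
      den = product (map (λ i → q ^ (d ∸ i) ∸ 1) (upTo d))
      K = q ^ (d * n)
      G : ℚ
      G = gaussBinom q (n + d) d ÷ℕ K
      instance
        den≢0 : NonZero den
        den≢0 = product≢0 (map⁺ (All.map denominator-factor-≢0 (all-upTo d)))
        K≢0 : NonZero K
        K≢0 = ℕ.m^n≢0 q (d * n)
      den′ K′ : ℚ
      den′ = ℕtoℚ den
      K′ = ℕtoℚ K
      K*den≤num : K * den ℕ.≤ num
      K*den≤num = subst (λ k → k * den ℕ.≤ num) q^n^d≡K
        (product-scale-≤ _ _ (upTo d) (All.map (λ i<d → numerator-factor-≥ n (ℕ.<⇒≤ i<d)) (all-upTo d)))
        where
        q^n^d≡K : (q ^ n) ^ length (upTo d) ≡ K
        q^n^d≡K = trans (cong ((q ^ n) ^_) (length-upTo d)) (trans (ℕ.^-*-assoc q n d) (cong (q ^_) (ℕ.*-comm n d)))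

    gaussBinom-choose-1 : ∀ n → gaussBinom q (n + 1) 1 ℚ.* (ℕtoℚ q ℚ.- 1ℚ) ≡ ℕtoℚ (q ^ n) ℚ.* ℕtoℚ q ℚ.- 1ℚ
    gaussBinom-choose-1 n = begin
      G ℚ.* (ℕtoℚ q ℚ.- 1ℚ)              ≡⟨ cong (G ℚ.*_) den≡q-1 ⟨
      G ℚ.* ℕtoℚ den                     ≡⟨ ℚ.*-comm G (ℕtoℚ den) ⟩
      ℕtoℚ den ℚ.* G                     ≡⟨ *-÷ℕ-inverse (ℕtoℚ num) den ⟩
      ℕtoℚ num                           ≡⟨ cong ℕtoℚ num≡ ⟩
      ℕtoℚ (q ^ n * q ∸ 1)               ≡⟨ ℕtoℚ-∸ (ℕ.*-mono-≤ (ℕ.m^n>0 q n) (ℕ.>-nonZero⁻¹ q)) ⟩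
      ℕtoℚ (q ^ n * q) ℚ.- 1ℚ            ≡⟨ cong (ℚ._- 1ℚ) (ℕtoℚ-* (q ^ n) q) ⟩
      ℕtoℚ (q ^ n) ℚ.* ℕtoℚ q ℚ.- 1ℚ     ∎
      where
      open ≡-Reasoning
      num den : ℕ
      num = (q ^ (n + 1) ∸ 1) * 1
      den = (q ^ 1 ∸ 1) * 1
      G : ℚ
      G = gaussBinom q (n + 1) 1
      instance
        den≢0 : NonZero den
        den≢0 = product≢0 (map⁺ (All.map denominator-factor-≢0 (all-upTo 1)))
      den≡q-1 : ℕtoℚ den ≡ ℕtoℚ q ℚ.- 1ℚ
      den≡q-1 = trans (cong ℕtoℚ (trans (ℕ.*-identityʳ _) (cong (_∸ 1) (ℕ.*-identityʳ q))))
                      (ℕtoℚ-∸ (ℕ.>-nonZero⁻¹ q))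
      num≡ : num ≡ q ^ n * q ∸ 1
      num≡ = trans (ℕ.*-identityʳ _)
               (cong (_∸ 1) (trans (ℕ.^-distribˡ-+-* q n 1) (cong (q ^ n *_) (ℕ.*-identityʳ q))))

module _ where
  open import Data.Nat.Base using (_≤_; _^_; NonZero; NonTrivial; nonTrivial⇒n>1; nonTrivial⇒nonZero)
  import Data.Nat.Properties as ℕ
  open import Data.Nat.Primality using (prime⇒nonTrivial)
  open import Data.Product.Base using (_,_)
  open import Relation.Binary.PropositionalEquality.Core using (refl)

  IsPrimePower⇒2≤ : ∀ {q} → IsPrimePower q → 2 ≤ q
  IsPrimePower⇒2≤ (p , k , p-prime , refl) = ℕ.≤-trans (nonTrivial⇒n>1 p) (ℕ.m≤m*n p (p ^ k) {{ℕ.m^n≢0 p k}})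
    where
    instance
      p-nonTrivial : NonTrivial p
      p-nonTrivial = prime⇒nonTrivial p-prime
      p-nonZero : NonZero p
      p-nonZero = nonTrivial⇒nonZero p

open import Algebra.Bundles using (CommutativeRing)
open import Data.Nat using (ℕ; _+_; _*_; _^_; _≤_)
open import Data.List using (List; length)
open import Data.List.Relation.Unary.AllPairs using (AllPairs)
open import Data.Product using (_×_; _,_)
open import Relation.Nullary using (¬_; Dec)
open import Relation.Binary.PropositionalEquality using (_≡_; refl; trans; cong)
open import Data.Rational as ℚ using (ℚ)
open import Data.Nat.Base using (NonZero; >-nonZero; s≤s; z≤n)
import Data.Nat.Properties as ℕ
open MomentBounds
open GaussianBinomial

theorem1p8 : ∀ {c ℓ} (q : ℕ) → IsPrimePower q
    → (K : CommutativeRing c ℓ) → IsFiniteField K q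
    → (n d : ℕ) → 1 ≤ n → 1 ≤ d
    → let open AffineGeometry K in
      (Ps : List (Point (n + d))) → AllPairs (λ x y → ¬ (x ≈ₚ y)) Ps
    → (Fs : List (Flat (n + d) n)) → AllPairs (λ F G → ¬ SameFlat F G) Fs
    → (mem? : ∀ (x : Point (n + d)) (F : Flat (n + d) n) → Dec (x ∈F F))
    → let P = ℕtoℚ (length Ps)
          F = ℕtoℚ (length Fs)
          I = ℕtoℚ (incidences mem? Ps Fs)
          Q = ℕtoℚ q
      in (2 ≤ d →
            let D = I ℚ.- ((P ℚ.* F) ÷ℕ (q ^ d)) in
            D ℚ.* D ℚ.≤ ℕtoℚ (q ^ n) ℚ.* (P ℚ.* F)
                         ℚ.* ((F ÷ℕ q) ℚ.+ (gaussBinom q (n + d) d ÷ℕ (q ^ (d * n)))))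
       × (d ≡ 1 →
            let D = I ℚ.- ((P ℚ.* F) ÷ℕ q)
                E = ℚ.1ℚ ℚ.- (ℚ.1ℚ ÷ℕ q) in
            D ℚ.* D ℚ.≤ ℕtoℚ (q ^ n) ℚ.* (E ℚ.* E) ℚ.* (P ℚ.* F)
                         ℚ.* (gaussBinom q (n + 1) 1 ÷ℕ (q ^ n)))
theorem1p8 q q-prime-power K K-field n d _ _ Ps Ps! Fs Fs! mem? =
    (λ _ → incidence-bound (moments (ℕ.^-distribˡ-+-* q n d)) (gaussBinom-≥1 2≤q n d))
  , (λ { refl → incidence-bound-hyperplane (moments q^[n+1]≡q^n*q) (gaussBinom-choose-1 2≤q n) })
  where
  open AffineGeometry K using (incidences)
  open FiniteAffineSpace K K-field
  open Incidence mem?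
  2≤q : 2 ≤ q
  2≤q = IsPrimePower⇒2≤ q-prime-power
  instance
    q≢0 : NonZero q
    q≢0 = >-nonZero (ℕ.≤-trans (s≤s z≤n) 2≤q)
    q^n≢0 : NonZero (q ^ n)
    q^n≢0 = ℕ.m^n≢0 q n
    q^d≢0 : NonZero (q ^ d)
    q^d≢0 = ℕ.m^n≢0 q d
  moments : ∀ {D} → q ^ (n + d) ≡ q ^ n * D → SplitMoments q (q ^ n) D (length Ps) (length Fs) (incidences mem? Ps Fs)
  moments q^m≡QD = split-moments Ps Ps! q^m≡QD Fs Fs!
  q^[n+1]≡q^n*q : q ^ (n + 1) ≡ q ^ n * q
  q^[n+1]≡q^n*q = trans (ℕ.^-distribˡ-+-* q n 1) (cong (q ^ n *_) (ℕ.*-identityʳ q))
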